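{- Let $N\ge 3$ and let $W_{N+1}$ be the wheel graph with vertices $v_0,\dots,v_N$, where $v_0,\dots,v_{N-1}$ form a cycle (edges $v_iv_{i+1}$, indices mod $N$) and the central vertex $v_N$ is adjacent to every $v_i$, $0\le i\le N-1$. For $1\le \ell\le N-1$, let $\tau(W_{N+1};0,\ell)$ be the number of spanning trees of the multigraph obtained from $W_{N+1}$ by identifying $v_0$ and $v_\ell$. Then \[ \tau(W_{N+1};0,\ell)=\begin{cases}2(F_N-F_{N-2\ell})(F_{N-1}+F_{N+1}) & \text{if } N \text{ is odd},\\[2mm] \dfrac{2(L_N-L_{N-2\ell})(L_N-2)(L_N+2)}{L_{N-1}+L_{N+1}} & \text{if } N \text{ is even}.\end{cases} \]
   Context: Identifying two vertices $u,v$ means replacing them by a single vertex incident to all edges formerly incident to $u$ or $v$ (parallel edges are kept, an edge $uv$ becomes a loop); spanning trees of the resulting multigraph are counted as edge subsets, so parallel edges give distinct trees and loops are never used. $F_n$ denotes the Fibonacci numbers ($F_0=0$, $F_1=1$, $F_{n+2}=F_{n+1}+F_n$) and $L_n$ the Lucas numbers ($L_0=2$, $L_1=1$, $L_{n+2}=L_{n+1}+L_n$), both extended to negative indices by the same recurrence (so $F_{ -n}=(-1)^{n+1}F_n$, $L_{ -n}=(-1)^nL_n$). -}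

module Defs where

open import Data.Nat as ℕ using (ℕ; zero; suc; _%_)
open import Data.Integer as ℤ using (ℤ; +_; -[1+_])
open import Data.Fin using (Fin; zero; suc; toℕ; inject₁; fromℕ; punchOut; _≟_)
open import Data.Product using (_×_; _,_; Σ; proj₁; proj₂)
open import Data.List using (List; []; _∷_; _++_; map; allFin; length; lookup)
open import Data.List.Relation.Unary.Unique.Propositional using (Unique)
import Data.List.Membership.Propositional as ListMem
open import Data.Fin.Subset using (Subset) renaming (_∈_ to _∈ₛ_)
open import Function.Bundles using (_⇔_)
open import Relation.Nullary using (yes; no)
open import Relation.Binary.PropositionalEquality using (_≡_; _≢_; sym)
open import Function using (_∘_)
open import Data.Nat.DivMod using (_mod_)

-- Multigraphs on the vertex set Fin n: a list of edges (u , v).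
-- Parallel edges are distinct list entries; (u , u) is a loop.

Multigraph : ℕ → Set
Multigraph n = List (Fin n × Fin n)

next : ∀ {N} → Fin N → Fin N
next {suc k} i = suc (toℕ i) mod (suc k)

wheel : (N : ℕ) → Multigraph (suc N)
wheel N = map (λ i → (inject₁ i , inject₁ (next i))) (allFin N)
       ++ map (λ i → (inject₁ i , fromℕ N)) (allFin N)

-- All edges are
-- kept (parallel edges stay parallel, an edge uv becomes a loop).

mergeVertex : ∀ {n} (u v : Fin (suc n)) → u ≢ v → Fin (suc n) → Fin n
mergeVertex u v u≢v w with v ≟ w
... | yes _ = punchOut {i = v} {j = u} (u≢v ∘ sym)
... | no v≢w = punchOut {i = v} {j = w} v≢w

identify : ∀ {n} (u v : Fin (suc n)) → u ≢ v → Multigraph (suc n) → Multigraph n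
identify u v u≢v = map (λ e → (f (proj₁ e) , f (proj₂ e)))
  where f = mergeVertex u v u≢v

module _ {n : ℕ} (G : Multigraph n) where

  EdgeIx : Set
  EdgeIx = Fin (length G)

  data Joins (e : EdgeIx) (u w : Fin n) : Set where
    fwd : lookup G e ≡ (u , w) → Joins e u w
    bwd : lookup G e ≡ (w , u) → Joins e u w

  data Walk (S : Subset (length G)) : Fin n → Fin n → List EdgeIx → Set where
    done : ∀ {u} → Walk S u u []
    step : ∀ {u w x es} (e : EdgeIx) → e ∈ₛ S → Joins e u w →
           Walk S w x es → Walk S u x (e ∷ es)

  Connected : Subset (length G) → Set
  Connected S = ∀ u v → Σ (List EdgeIx) (Walk S u v)

  -- no cycle: every closed walk with pairwise distinct edges is trivial
  -- (a loop or a pair of parallel edges counts as a cycle)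
  Acyclic : Subset (length G) → Set
  Acyclic S = ∀ u es → Walk S u u es → Unique es → es ≡ []

  IsSpanningTree : Subset (length G) → Set
  IsSpanningTree S = Connected S × Acyclic S

  SpanningTreeCount : ℕ → Set
  SpanningTreeCount k =
    Σ (List (Subset (length G))) λ L →
      Unique L × (∀ S → (S ListMem.∈ L) ⇔ IsSpanningTree S) × length L ≡ k

-- Fibonacci and Lucas numbers, extended to ℤ:
-- F_{-k} = (-1)^{k+1} F_k,  L_{-k} = (-1)^k L_k.

fib : ℕ → ℕ
fib 0 = 0
fib 1 = 1
fib (suc (suc n)) = fib (suc n) ℕ.+ fib n

luc : ℕ → ℕ
luc 0 = 2
luc 1 = 1
luc (suc (suc n)) = luc (suc n) ℕ.+ luc n

alt : ℕ → ℤ → ℤ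
alt zero x = x
alt (suc k) x = ℤ.- alt k x

F : ℤ → ℤ
F (+ n) = + fib n
F -[1+ n ] = alt n (+ fib (suc n))

L : ℤ → ℤ
L (+ n) = + luc n
L -[1+ n ] = alt (suc n) (+ luc (suc n))

-- Spanning trees are counted by deletion–contraction, processing the rim
-- vertices v_1, …, v_N = v₀ in turn: at stage i the rim edge v_{i-1}v_i and then
-- the spoke at v_i are deleted or contracted.  Contraction is modelled by
-- relabelling vertices, and between stages only the partition of the boundary
-- vertices matters: whether the root v₀ = v_ℓ is joined to the hub, and whether
-- v_{i-1} lies with the hub, with the root or alone.  The counts for these five
-- states obey linear recurrences with Fibonacci solutions, which give
--   τ = 2 (F_{2N} − F_{2ℓ} − F_{2(N−ℓ)}).
-- With d = |N − 2ℓ|, the identities F_{2a} + F_{2b} = L_{a+b} F_d (d odd) or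
-- F_{a+b} L_d (d even), F_{2N} = F_N L_N and L_N² = 5 F_N² + 4 (N even) turn this
-- into the stated closed forms.

{-# OPTIONS --safe #-}
module Submission where

module Auxiliary where

  open import Data.Nat using (ℕ)
  open import Data.Fin using (Fin)
  open import Data.Fin.Subset using (Subset; inside; outside) renaming (_∈_ to _∈ₛ_; _∉_ to _∉ₛ_)
  open import Data.Vec using (_[_]≔_; lookup)
  open import Data.Vec.Properties using ([]≔-minimal; []≔-idempotent; []≔-lookup; []≔-updates; []=-injective)
  open import Data.List using (List; []; _∷_; _++_; map)
  open import Data.List.Membership.Propositional using (_∈_; _∉_)
  open import Data.List.Membership.Propositional.Properties using (∈-map⁻)
  open import Data.List.Relation.Unary.Any using (here; there)
  open import Data.List.Relation.Unary.All.Properties using (¬Any⇒All¬; All¬⇒¬Any)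
  open import Data.List.Relation.Unary.Unique.Propositional using (Unique; []; _∷_)
  open import Data.Product using (_,_)
  open import Data.Empty using (⊥-elim)
  open import Relation.Nullary using (yes; no)
  open import Relation.Binary.Definitions using (DecidableEquality)
  open import Relation.Binary.PropositionalEquality using (_≡_; _≢_; refl; sym; trans; subst)

  Unique-++⁻ʳ : ∀ {A : Set} (xs : List A) {ys} → Unique (xs ++ ys) → Unique ys
  Unique-++⁻ʳ [] u = u
  Unique-++⁻ʳ (x ∷ xs) (_ ∷ u) = Unique-++⁻ʳ xs u

  Unique-head∉ : ∀ {A : Set} {x : A} {xs} → Unique (x ∷ xs) → x ∉ xs
  Unique-head∉ (x∉ ∷ _) = All¬⇒¬Any x∉

  Unique-map⁺ : ∀ {A B : Set} {g : A → B} {xs} → (∀ {x y} → x ∈ xs → y ∈ xs → g x ≡ g y → x ≡ y) →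
                Unique xs → Unique (map g xs)
  Unique-map⁺ injective [] = []
  Unique-map⁺ {g = g} {x ∷ xs} injective (x∉ ∷ u) =
    ¬Any⇒All¬ (map g xs) gx∉ ∷ Unique-map⁺ (λ p q → injective (there p) (there q)) u
    where
    gx∉ : g x ∉ map g xs
    gx∉ gx∈ with ∈-map⁻ g gx∈
    ... | y , y∈ , gx≡gy = Unique-head∉ (x∉ ∷ u) (subst (_∈ xs) (sym (injective (here refl) (there y∈) gx≡gy)) y∈)

  relabel : {L : Set} → DecidableEquality L → L → L → L → L
  relabel _≟_ t s u with u ≟ t
  ... | yes _ = s
  ... | no _ = u

  relabel-≡ : {L : Set} (_≟_ : DecidableEquality L) → ∀ t s → relabel _≟_ t s t ≡ s
  relabel-≡ _≟_ t s with t ≟ t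
  ... | yes _ = refl
  ... | no t≢t = ⊥-elim (t≢t refl)

  relabel-≢ : {L : Set} (_≟_ : DecidableEquality L) → ∀ t s u → u ≢ t → relabel _≟_ t s u ≡ u
  relabel-≢ _≟_ t s u u≢t with u ≟ t
  ... | yes u≡t = ⊥-elim (u≢t u≡t)
  ... | no _ = refl

  module _ {n : ℕ} {T : Subset n} {d e : Fin n} where

    ∈-[]≔⁺ : ∀ {s} → e ≢ d → e ∈ₛ T → e ∈ₛ T [ d ]≔ s
    ∈-[]≔⁺ e≢d = []≔-minimal T e d e≢d

    ∈-[]≔⁻ : ∀ {s} → e ≢ d → e ∈ₛ T [ d ]≔ s → e ∈ₛ T
    ∈-[]≔⁻ {s} e≢d e∈ = subst (e ∈ₛ_) restore ([]≔-minimal (T [ d ]≔ s) e d e≢d e∈)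
      where
      restore : (T [ d ]≔ s) [ d ]≔ lookup T d ≡ T
      restore = trans ([]≔-idempotent T d) ([]≔-lookup T d)

  ∈-[]≔inside : ∀ {n} (T : Subset n) d → d ∈ₛ T [ d ]≔ inside
  ∈-[]≔inside T d = []≔-updates T d

  ∉-[]≔outside : ∀ {n} (T : Subset n) d → d ∉ₛ T [ d ]≔ outside
  ∉-[]≔outside T d d∈ with []=-injective d∈ ([]≔-updates T d)
  ... | ()

module LabelledGraphs where

  open Auxiliary
  open import Data.Nat using (ℕ; _<_; _+_)
  open import Data.Fin using (Fin)
  open import Data.Fin.Subset using (Subset; inside; outside; ⊥) renaming (_∈_ to _∈ₛ_; _∉_ to _∉ₛ_)
  open import Data.Vec using (_[_]≔_)
  open import Data.Fin.Properties as Fin using ()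
  open import Data.List using (List; []; _∷_; _++_; map; length)
  open import Data.List.Membership.Propositional using (_∈_; _∉_)
  open import Data.List.Membership.Propositional.Properties using (∈-map⁻; ∈-map⁺; ∈-++⁻; ∈-++⁺ˡ; ∈-++⁺ʳ)
  open import Data.List.Properties using (length-++; length-map)
  import Data.List.Relation.Unary.Unique.Propositional.Properties as Unique
  open import Function using (_∘_; case_of_)
  open import Data.List.Relation.Unary.Any using (here; there)
  open import Data.List.Relation.Unary.All using (All; []; _∷_)
  open import Data.List.Relation.Unary.All.Properties using (¬Any⇒All¬)
  open import Data.List.Relation.Unary.Unique.Propositional using (Unique; []; _∷_)
  open import Data.Product using (_×_; _,_; Σ; proj₁; proj₂)
  open import Data.Sum using (_⊎_; inj₁; inj₂)
  import Data.Sum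
  open import Data.Empty using (⊥-elim)
  open import Data.Fin.Subset.Properties using (⊆-antisym; Empty-unique; ∉⊥) renaming (_∈?_ to _∈ₛ?_)
  open import Function.Bundles using (_⇔_; mk⇔; Equivalence)
  open import Relation.Nullary using (¬_; yes; no)
  open import Relation.Binary.Definitions using (DecidableEquality)
  open import Relation.Binary.PropositionalEquality using (_≡_; _≢_; refl; sym; trans; cong; cong₂; subst)

  -- A multigraph with edges Fin m whose ends are natural numbers; vertices
  -- are identified through a labelling f : ℕ → L, so that contracting an
  -- edge is relabelling rather than renumbering.
  module Graph (m : ℕ) (ends : Fin m → ℕ × ℕ) {L : Set} (_≟L_ : DecidableEquality L) where

    open import Data.List.Membership.DecPropositional (Fin._≟_ {m}) using (_∈?_)

    EdgeSet : Set₁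
    EdgeSet = Fin m → Set

    _∖_ : EdgeSet → Fin m → EdgeSet
    (P ∖ d) e = P e × e ≢ d

    data Joins (d : Fin m) (a b : ℕ) : Set where
      fwd : ends d ≡ (a , b) → Joins d a b
      bwd : ends d ≡ (b , a) → Joins d a b

    Joins-sym : ∀ {d a b} → Joins d a b → Joins d b a
    Joins-sym (fwd e) = bwd e
    Joins-sym (bwd e) = fwd e

    Joins-ends : ∀ {d a b a' b'} → Joins d a b → Joins d a' b' → (a' ≡ a × b' ≡ b) ⊎ (a' ≡ b × b' ≡ a)
    Joins-ends (fwd e) (fwd e') with trans (sym e) e'
    ... | refl = inj₁ (refl , refl)
    Joins-ends (fwd e) (bwd e') with trans (sym e) e'
    ... | refl = inj₂ (refl , refl)
    Joins-ends (bwd e) (fwd e') with trans (sym e) e'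
    ... | refl = inj₂ (refl , refl)
    Joins-ends (bwd e) (bwd e') with trans (sym e) e'
    ... | refl = inj₁ (refl , refl)

    data Walk (f : ℕ → L) (P : EdgeSet) : ℕ → ℕ → List (Fin m) → Set where
      done : ∀ {x y} → f x ≡ f y → Walk f P x y []
      step : ∀ {x a b y es} (d : Fin m) → P d → Joins d a b → f x ≡ f a →
             Walk f P b y es → Walk f P x y (d ∷ es)

    Connected : (ℕ → L) → EdgeSet → ℕ → Set
    Connected f P n = ∀ x y → x < n → y < n → Σ (List (Fin m)) (Walk f P x y)

    Acyclic : (ℕ → L) → EdgeSet → Set
    Acyclic f P = ∀ x es → Walk f P x x es → Unique es → es ≡ []

    SpanningTree : (ℕ → L) → EdgeSet → ℕ → Set
    SpanningTree f P n = Connected f P n × Acyclic f P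

    -- Forests are handled through this equivalent form, which contraction preserves.
    AllBridges : (ℕ → L) → EdgeSet → Set
    AllBridges f P = ∀ d a b → P d → ends d ≡ (a , b) → ∀ es → ¬ Walk f (P ∖ d) a b es

    module _ {f : ℕ → L} where

      startAt : ∀ {P x x' y es} → f x ≡ f x' → Walk f P x' y es → Walk f P x y es
      startAt e (done e') = done (trans e e')
      startAt e (step d p j e' w) = step d p j (trans e e') w

      endAt : ∀ {P x y y' es} → f y ≡ f y' → Walk f P x y es → Walk f P x y' es
      endAt e (done e') = done (trans e' e)
      endAt e (step d p j e' w) = step d p j e' (endAt e w)

      Walk-mono : ∀ {P Q x y es} → (∀ d → P d → Q d) → Walk f P x y es → Walk f Q x y es
      Walk-mono P⊆Q (done e) = done e
      Walk-mono P⊆Q (step d p j e w) = step d (P⊆Q d p) j e (Walk-mono P⊆Q w)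

      _++ᵂ_ : ∀ {P x y z es es'} → Walk f P x y es → Walk f P y z es' → Walk f P x z (es ++ es')
      done e ++ᵂ w' = startAt e w'
      step d p j e w ++ᵂ w' = step d p j e (w ++ᵂ w')

      reverseᵂ : ∀ {P x y es} → Walk f P x y es → Σ (List (Fin m)) (Walk f P y x)
      reverseᵂ (done e) = [] , done (sym e)
      reverseᵂ (step d p j e w) =
        let (es' , w') = reverseᵂ w in es' ++ d ∷ [] , w' ++ᵂ step d p (Joins-sym j) refl (done (sym e))

      avoiding : ∀ {P x y es d} → Walk f P x y es → d ∉ es → Walk f (P ∖ d) x y es
      avoiding (done e) d∉ = done e
      avoiding (step d' p j e w) d∉ = step d' (p , λ d'≡d → d∉ (here (sym d'≡d))) j e (avoiding w (d∉ ∘ there))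

      avoids : ∀ {P x y es d} → Walk f (P ∖ d) x y es → All (d ≢_) es
      avoids (done e) = []
      avoids (step d' (p , d'≢d) j e w) = (λ d≡d' → d'≢d (sym d≡d')) ∷ avoids w

      suffixAfter : ∀ {P x y es d} → Walk f P x y es → d ∈ es →
        Σ ℕ λ a → Σ ℕ λ b → Σ (List (Fin m)) λ pre → Σ (List (Fin m)) λ post →
          Joins d a b × Walk f P b y post × es ≡ pre ++ d ∷ post
      suffixAfter (step {a = a} {b = b} {es = es} d p j e w) (here refl) = a , b , [] , es , j , w , refl
      suffixAfter (step d' p j e w) (there d∈) =
        let (a , b , pre , post , j' , w' , es≡) = suffixAfter w d∈ in
        a , b , d' ∷ pre , post , j' , w' , cong (d' ∷_) es≡

      -- If the first edge d recurs in the trail of the rest, only what follows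
      -- that occurrence is kept (without d, if d is crossed back the other way).
      trail : ∀ {P x y es} → Walk f P x y es → Σ (List (Fin m)) λ es' → Walk f P x y es' × Unique es'
      trail (done e) = [] , done e , []
      trail (step d p j e w) with trail w
      ... | es' , w' , u' with d ∈? es'
      ... | no d∉ = d ∷ es' , step d p j e w' , ¬Any⇒All¬ es' d∉ ∷ u'
      ... | yes d∈ with suffixAfter w' d∈
      ... | _ , _ , pre , post , j' , w'' , refl with Unique-++⁻ʳ pre u' | Joins-ends j j'
      ... | u'' | inj₁ (refl , refl) = d ∷ post , step d p j e w'' , u''
      ... | _ ∷ u'' | inj₂ (refl , refl) = post , startAt e w'' , u''

      AllBridges⇒Acyclic : ∀ {P} → AllBridges f P → Acyclic f P
      AllBridges⇒Acyclic bridges x [] w u = refl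
      AllBridges⇒Acyclic bridges x (d ∷ es) (step d p (fwd ends≡) e w) u =
        ⊥-elim (bridges d _ _ p ends≡ _ (proj₂ (reverseᵂ (endAt e (avoiding w (Unique-head∉ u))))))
      AllBridges⇒Acyclic bridges x (d ∷ es) (step d p (bwd ends≡) e w) u =
        ⊥-elim (bridges d _ _ p ends≡ _ (endAt e (avoiding w (Unique-head∉ u))))

      Acyclic⇒AllBridges : ∀ {P} → Acyclic f P → AllBridges f P
      Acyclic⇒AllBridges acyclic d a b p ends≡ es w
        with trail w
      ... | es' , w' , u' with acyclic b (d ∷ es') (step d p (bwd ends≡) refl (Walk-mono (λ _ → proj₁) w')) (avoids w' ∷ u')
      ... | ()

      SpanningTree-cong : ∀ {P Q n} → (∀ d → P d → Q d) → (∀ d → Q d → P d) → SpanningTree f P n → SpanningTree f Q n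
      SpanningTree-cong P⊆Q Q⊆P (connected , acyclic) =
        (λ x y x<n y<n → let (es , w) = connected x y x<n y<n in es , Walk-mono P⊆Q w) ,
        (λ x es w u → acyclic x es (Walk-mono Q⊆P w) u)

      loop⇒¬Acyclic : ∀ {P d a b} → P d → ends d ≡ (a , b) → f a ≡ f b → ¬ Acyclic f P
      loop⇒¬Acyclic {d = d} p ends≡ fa≡fb acyclic
        with acyclic _ (d ∷ []) (step d p (fwd ends≡) refl (done (sym fa≡fb))) ([] ∷ [])
      ... | ()

      isolated⇒¬Connected : ∀ {P n x y} → x < n → y < n → f x ≢ f y →
        (∀ d a b → P d → ends d ≡ (a , b) → f a ≢ f x × f b ≢ f x) → ¬ Connected f P n
      isolated⇒¬Connected x<n y<n fx≢fy isolated connected with connected _ _ x<n y<n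
      ... | [] , done e = fx≢fy e
      ... | _ , step d p (fwd ends≡) e w = proj₁ (isolated d _ _ p ends≡) (sym e)
      ... | _ , step d p (bwd ends≡) e w = proj₂ (isolated d _ _ p ends≡) (sym e)

      SpanningTree-∅ : ∀ {P n} → (∀ d → ¬ P d) → (∀ x y → x < n → y < n → f x ≡ f y) → SpanningTree f P n
      SpanningTree-∅ empty trivial =
        (λ x y x<n y<n → [] , done (trivial x y x<n y<n)) ,
        λ { x [] w u → refl ; x (d ∷ es) (step d p _ _ _) u → ⊥-elim (empty d p) }

      SpanningTree-∅⁻ : ∀ {P n} → (∀ d → ¬ P d) → SpanningTree f P n → ∀ x y → x < n → y < n → f x ≡ f y
      SpanningTree-∅⁻ empty (connected , _) x y x<n y<n with connected x y x<n y<n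
      ... | [] , done e = e
      ... | _ , step d p _ _ _ = ⊥-elim (empty d p)

    contract : (ℕ → L) → ℕ → ℕ → ℕ → L
    contract f a b x = relabel _≟L_ (f b) (f a) (f x)

    module _ (f : ℕ → L) (a b : ℕ) where

      EndClass : ℕ → Set
      EndClass x = f x ≡ f a ⊎ f x ≡ f b

      ContractedTogether : ℕ → ℕ → Set
      ContractedTogether x y = f x ≡ f y ⊎ EndClass x × EndClass y

      contract-end : ∀ {x} → EndClass x → contract f a b x ≡ f a
      contract-end {x} x∈ab with f x ≟L f b
      ... | yes _ = refl
      ... | no fx≢fb with x∈ab
      ... | inj₁ fx≡fa = fx≡fa
      ... | inj₂ fx≡fb = ⊥-elim (fx≢fb fx≡fb)

      contract-cong : ∀ {x y} → f x ≡ f y → contract f a b x ≡ contract f a b y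
      contract-cong {x} {y} e = cong (relabel _≟L_ (f b) (f a)) e

      contract-≡⁻ : ∀ {x y} → contract f a b x ≡ contract f a b y → ContractedTogether x y
      contract-≡⁻ {x} {y} e with f x ≟L f b | f y ≟L f b
      ... | yes p | yes q = inj₁ (trans p (sym q))
      ... | yes p | no q = inj₂ (inj₂ p , inj₁ (sym e))
      ... | no p | yes q = inj₂ (inj₁ e , inj₂ q)
      ... | no p | no q = inj₁ e

      contract-≡⁺ : ∀ {x y} → ContractedTogether x y → contract f a b x ≡ contract f a b y
      contract-≡⁺ (inj₁ e) = contract-cong e
      contract-≡⁺ (inj₂ (x∈ab , y∈ab)) = trans (contract-end x∈ab) (sym (contract-end y∈ab))

    ContractedTogether-swap : ∀ f a b {x y} → ContractedTogether f a b x y → ContractedTogether f b a x y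
    ContractedTogether-swap f a b (inj₁ e) = inj₁ e
    ContractedTogether-swap f a b (inj₂ (x∈ab , y∈ab)) = inj₂ (Data.Sum.swap x∈ab , Data.Sum.swap y∈ab)

    module Contraction {f : ℕ → L} {d : Fin m} {a b : ℕ} (ends≡ : ends d ≡ (a , b)) where

      private
        f' : ℕ → L
        f' = contract f a b

      Joins⇒contracted : ∀ {a' b'} → Joins d a' b' → f' a' ≡ f' b'
      Joins⇒contracted j with Joins-ends (fwd ends≡) j
      ... | inj₁ (refl , refl) = contract-≡⁺ f a b (inj₂ (inj₁ refl , inj₂ refl))
      ... | inj₂ (refl , refl) = contract-≡⁺ f a b (inj₂ (inj₂ refl , inj₁ refl))

      Walk-contract : ∀ {P x y es} → Walk f P x y es → Σ (List (Fin m)) (Walk f' (P ∖ d) x y)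
      Walk-contract (done e) = [] , done (contract-cong f a b e)
      Walk-contract (step d' p j e w) with d' Fin.≟ d | Walk-contract w
      ... | yes refl | es' , w' = es' , startAt (trans (contract-cong f a b e) (Joins⇒contracted j)) w'
      ... | no d'≢d | es' , w' = d' ∷ es' , step d' (p , d'≢d) j (contract-cong f a b e) w'

      Walk-coarsen : ∀ {P x y es} → Walk f P x y es → Walk f' P x y es
      Walk-coarsen (done e) = done (contract-cong f a b e)
      Walk-coarsen (step d' p j e w) = step d' p j (contract-cong f a b e) (Walk-coarsen w)

      module _ {P : EdgeSet} (d∈P : P d) where

        jump : ∀ {x z y es} → f' x ≡ f' z → Walk f P z y es → Σ (List (Fin m)) (Walk f P x y)
        jump e w with contract-≡⁻ f a b e
        ... | inj₁ fx≡fz = _ , startAt fx≡fz w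
        ... | inj₂ (inj₁ fx≡fa , inj₁ fz≡fa) = _ , startAt (trans fx≡fa (sym fz≡fa)) w
        ... | inj₂ (inj₁ fx≡fa , inj₂ fz≡fb) = _ , step d d∈P (fwd ends≡) fx≡fa (startAt (sym fz≡fb) w)
        ... | inj₂ (inj₂ fx≡fb , inj₁ fz≡fa) = _ , step d d∈P (bwd ends≡) fx≡fb (startAt (sym fz≡fa) w)
        ... | inj₂ (inj₂ fx≡fb , inj₂ fz≡fb) = _ , startAt (trans fx≡fb (sym fz≡fb)) w

        Walk-uncontract : ∀ {Q x y es} → (∀ e → Q e → P e) → Walk f' Q x y es → Σ (List (Fin m)) (Walk f P x y)
        Walk-uncontract Q⊆P (done e) = jump e (done refl)
        Walk-uncontract Q⊆P (step d' q j e w) =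
          jump e (step d' (Q⊆P d' q) j refl (proj₂ (Walk-uncontract Q⊆P w)))

    module _ {f : ℕ → L} {S : EdgeSet} {n : ℕ} {d : Fin m} {a b : ℕ}
             (d∈S : S d) (ends≡ : ends d ≡ (a , b)) (fa≢fb : f a ≢ f b) where
      open Contraction {f} {d} {a} {b} ends≡

      SpanningTree-contract : SpanningTree f S n → SpanningTree (contract f a b) (S ∖ d) n
      SpanningTree-contract (connected , acyclic) = connected' , AllBridges⇒Acyclic bridges
        where
        connected' : Connected (contract f a b) (S ∖ d) n
        connected' x y x<n y<n = Walk-contract (proj₂ (connected x y x<n y<n))
        bridges : AllBridges (contract f a b) (S ∖ d)
        bridges d' a' b' (d'∈S , d'≢d) ends'≡ es w =
          Acyclic⇒AllBridges acyclic d' a' b' d'∈S ends'≡ _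
            (proj₂ (Walk-uncontract (d∈S , λ d≡d' → d'≢d (sym d≡d')) (λ { _ ((e∈S , _) , e≢d') → e∈S , e≢d' }) w))

      SpanningTree-uncontract : SpanningTree (contract f a b) (S ∖ d) n → SpanningTree f S n
      SpanningTree-uncontract (connected , acyclic) = connected' , AllBridges⇒Acyclic bridges
        where
        connected' : Connected f S n
        connected' x y x<n y<n = Walk-uncontract d∈S (λ _ → proj₁) (proj₂ (connected x y x<n y<n))
        bridges : AllBridges f S
        bridges d' a' b' d'∈S ends'≡ es w with d' Fin.≟ d
        ... | no d'≢d = Acyclic⇒AllBridges acyclic d' a' b' (d'∈S , d'≢d) ends'≡ _
                          (Walk-mono (λ { _ ((e∈S , e≢d) , e≢d') → (e∈S , e≢d') , e≢d }) (proj₂ (Walk-contract w)))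
        ... | yes refl with trans (sym ends≡) ends'≡
        ... | refl with trail w
        ... | t , w' , u with acyclic a t (endAt (sym (Joins⇒contracted (fwd ends≡))) (Walk-coarsen w')) u
        ... | refl with w'
        ... | done fa≡fb = fa≢fb fa≡fb

    Within : List (Fin m) → Subset m → Set
    Within R T = ∀ {d} → d ∈ₛ T → d ∈ R

    TreeCount : (ℕ → L) → List (Fin m) → ℕ → ℕ → Set
    TreeCount f R n k = Σ (List (Subset m)) λ Ts → Unique Ts ×
      (∀ T → T ∈ Ts ⇔ (Within R T × SpanningTree f (_∈ₛ T) n)) × length Ts ≡ k

    Within-∷⁻ : ∀ {R T d} → d ∉ₛ T → Within (d ∷ R) T → Within R T
    Within-∷⁻ d∉T within e∈T with within e∈T
    ... | here refl = ⊥-elim (d∉T e∈T)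
    ... | there e∈R = e∈R

    Within-∉ : ∀ {R T d} → d ∉ R → Within R T → d ∉ₛ T
    Within-∉ d∉R within d∈T = d∉R (within d∈T)

    count-none : ∀ {f R n} → (∀ T → Within R T → ¬ SpanningTree f (_∈ₛ T) n) → TreeCount f R n 0
    count-none none = [] , [] , (λ T → mk⇔ (λ ()) λ (within , tree) → ⊥-elim (none T within tree)) , refl

    count-loop : ∀ {f R n k d a b} → ends d ≡ (a , b) → f a ≡ f b → TreeCount f R n k → TreeCount f (d ∷ R) n k
    count-loop {f} {R} {n} {d = d} ends≡ fa≡fb (Ts , u , mem , len) = Ts , u , mem' , len
      where
      mem' : ∀ T → T ∈ Ts ⇔ (Within (d ∷ R) T × SpanningTree f (_∈ₛ T) n)
      mem' T = mk⇔ to from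
        where
        to : T ∈ Ts → Within (d ∷ R) T × SpanningTree f (_∈ₛ T) n
        to T∈ = let (within , tree) = Equivalence.to (mem T) T∈ in there ∘ within , tree
        from : Within (d ∷ R) T × SpanningTree f (_∈ₛ T) n → T ∈ Ts
        from (within , tree) with d ∈ₛ? T
        ... | yes d∈T = ⊥-elim (loop⇒¬Acyclic d∈T ends≡ fa≡fb (proj₂ tree))
        ... | no d∉T = Equivalence.from (mem T) (Within-∷⁻ {R} d∉T within , tree)

    Within-[] : ∀ {T} → Within [] T → T ≡ ⊥
    Within-[] within = Empty-unique λ (_ , d∈T) → case within d∈T of λ ()

    count-[]-one : ∀ {f n} → (∀ x y → x < n → y < n → f x ≡ f y) → TreeCount f [] n 1
    count-[]-one {f} {n} trivial = ⊥ ∷ [] , [] ∷ [] , mem , refl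
      where
      mem : ∀ T → T ∈ ⊥ ∷ [] ⇔ (Within [] T × SpanningTree f (_∈ₛ T) n)
      mem T = mk⇔ (λ { (here refl) → (λ d∈ → ⊥-elim (∉⊥ d∈)) , SpanningTree-∅ (λ _ → ∉⊥) trivial })
                  (λ (within , _) → here (Within-[] within))

    count-[]-zero : ∀ {f n x y} → x < n → y < n → f x ≢ f y → TreeCount f [] n 0
    count-[]-zero x<n y<n fx≢fy = count-none λ T within tree →
      fx≢fy (SpanningTree-∅⁻ (λ _ → subst (λ U → _ ∉ₛ U) (sym (Within-[] within)) ∉⊥) tree _ _ x<n y<n)

    count-deletion-contraction : ∀ {f R n k₁ k₂ d a b} → d ∉ R → ends d ≡ (a , b) → f a ≢ f b →
      TreeCount f R n k₁ → TreeCount (contract f a b) R n k₂ → TreeCount f (d ∷ R) n (k₁ + k₂)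
    count-deletion-contraction {f} {R} {n} {d = d} {a} {b} d∉R ends≡ fa≢fb (Ts₁ , u₁ , mem₁ , len₁) (Ts₂ , u₂ , mem₂ , len₂) =
      Ts₁ ++ map add Ts₂ , unique , mem , trans (length-++ Ts₁) (cong₂ _+_ len₁ (trans (length-map add Ts₂) len₂))
      where
      add : Subset m → Subset m
      add T = T [ d ]≔ inside

      within₁ : ∀ {T} → T ∈ Ts₁ → Within R T
      within₁ T∈ = proj₁ (Equivalence.to (mem₁ _) T∈)

      within₂ : ∀ {T} → T ∈ Ts₂ → Within R T
      within₂ T∈ = proj₁ (Equivalence.to (mem₂ _) T∈)

      ≢d : ∀ {T e} → d ∉ₛ T → e ∈ₛ T → e ≢ d
      ≢d d∉T e∈T refl = d∉T e∈T

      add-∖ : ∀ {T} → d ∉ₛ T → ∀ e → e ∈ₛ T → ((_∈ₛ add T) ∖ d) e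
      add-∖ d∉T e e∈T = ∈-[]≔⁺ (≢d d∉T e∈T) e∈T , ≢d d∉T e∈T

      add-∖⁻ : ∀ {T} e → ((_∈ₛ add T) ∖ d) e → e ∈ₛ T
      add-∖⁻ e (e∈ , e≢d) = ∈-[]≔⁻ e≢d e∈

      add-injective : ∀ {T T'} → d ∉ₛ T → d ∉ₛ T' → add T ≡ add T' → T ≡ T'
      add-injective {T} {T'} d∉T d∉T' eq = ⊆-antisym (transport d∉T eq) (transport d∉T' (sym eq))
        where
        transport : ∀ {U U'} → d ∉ₛ U → add U ≡ add U' → ∀ {e} → e ∈ₛ U → e ∈ₛ U'
        transport d∉U eq e∈U = add-∖⁻ _ (subst (λ V → _ ∈ₛ V) eq (proj₁ (add-∖ d∉U _ e∈U)) , ≢d d∉U e∈U)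

      add-remove : ∀ {T} → d ∈ₛ T → add (T [ d ]≔ outside) ≡ T
      add-remove {T} d∈T = ⊆-antisym ⊆ ⊇
        where
        ⊆ : ∀ {e} → e ∈ₛ add (T [ d ]≔ outside) → e ∈ₛ T
        ⊆ {e} e∈ with e Fin.≟ d
        ... | yes refl = d∈T
        ... | no e≢d = ∈-[]≔⁻ e≢d (∈-[]≔⁻ e≢d e∈)
        ⊇ : ∀ {e} → e ∈ₛ T → e ∈ₛ add (T [ d ]≔ outside)
        ⊇ {e} e∈T with e Fin.≟ d
        ... | yes refl = ∈-[]≔inside _ d
        ... | no e≢d = ∈-[]≔⁺ e≢d (∈-[]≔⁺ e≢d e∈T)

      unique : Unique (Ts₁ ++ map add Ts₂)
      unique = Unique.++⁺ u₁
                 (Unique-map⁺ (λ T∈ T'∈ → add-injective (Within-∉ d∉R (within₂ T∈)) (Within-∉ d∉R (within₂ T'∈))) u₂)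
                 λ (T∈₁ , T∈₂) → let (T₂ , _ , T≡) = ∈-map⁻ add T∈₂ in
                                 Within-∉ d∉R (within₁ T∈₁) (subst (d ∈ₛ_) (sym T≡) (∈-[]≔inside T₂ d))

      to : ∀ {T} → T ∈ Ts₁ ++ map add Ts₂ → Within (d ∷ R) T × SpanningTree f (_∈ₛ T) n
      to {T} T∈ with ∈-++⁻ Ts₁ T∈
      ... | inj₁ T∈₁ = let (within , tree) = Equivalence.to (mem₁ T) T∈₁ in there ∘ within , tree
      ... | inj₂ T∈₂ with ∈-map⁻ add T∈₂
      ... | T₂ , T₂∈ , refl = within' , SpanningTree-uncontract (∈-[]≔inside T₂ d) ends≡ fa≢fb
                                          (SpanningTree-cong (add-∖ d∉T₂) add-∖⁻ tree)
        where
        d∉T₂ : d ∉ₛ T₂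
        d∉T₂ = Within-∉ d∉R (within₂ T₂∈)
        tree : SpanningTree (contract f a b) (_∈ₛ T₂) n
        tree = proj₂ (Equivalence.to (mem₂ T₂) T₂∈)
        within' : Within (d ∷ R) (add T₂)
        within' {e} e∈ with e Fin.≟ d
        ... | yes refl = here refl
        ... | no e≢d = there (within₂ T₂∈ (∈-[]≔⁻ e≢d e∈))

      from : ∀ {T} → Within (d ∷ R) T × SpanningTree f (_∈ₛ T) n → T ∈ Ts₁ ++ map add Ts₂
      from {T} (within , tree) with d ∈ₛ? T
      ... | no d∉T = ∈-++⁺ˡ (Equivalence.from (mem₁ T) (Within-∷⁻ {R} d∉T within , tree))
      ... | yes d∈T = subst (_∈ Ts₁ ++ map add Ts₂) (add-remove d∈T)
                        (∈-++⁺ʳ Ts₁ (∈-map⁺ add (Equivalence.from (mem₂ T₂) (within' , tree'))))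
        where
        T₂ : Subset m
        T₂ = T [ d ]≔ outside
        d∉T₂ : d ∉ₛ T₂
        d∉T₂ = ∉-[]≔outside T d
        within' : Within R T₂
        within' e∈ = Within-∷⁻ d∉T₂ (λ e∈' → within (∈-[]≔⁻ (≢d d∉T₂ e∈') e∈')) e∈
        tree' : SpanningTree (contract f a b) (_∈ₛ T₂) n
        tree' = SpanningTree-cong (λ e (e∈T , e≢d) → ∈-[]≔⁺ e≢d e∈T)
                                  (λ e e∈ → ∈-[]≔⁻ (≢d d∉T₂ e∈) e∈ , ≢d d∉T₂ e∈)
                  (SpanningTree-contract d∈T ends≡ fa≢fb tree)

      mem : ∀ T → T ∈ Ts₁ ++ map add Ts₂ ⇔ (Within (d ∷ R) T × SpanningTree f (_∈ₛ T) n)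
      mem T = mk⇔ to from

    record Describes (f g : ℕ → L) (Live : ℕ → Set) (n : ℕ) : Set where
      field
        sameClass : ∀ {x y} → x < n → y < n → Live x → Live y → f x ≡ f y ⇔ g x ≡ g y
        cover : ∀ {x} → x < n → Σ ℕ λ y → y < n × Live y × f x ≡ f y

    module _ {f g : ℕ → L} {Live : ℕ → Set} {n : ℕ} (desc : Describes f g Live n) where
      open Describes desc

      describes-≡ : ∀ {x y} → x < n → y < n → Live x → Live y → g x ≡ g y → f x ≡ f y
      describes-≡ x<n y<n x-live y-live = Equivalence.from (sameClass x<n y<n x-live y-live)

      describes-≢ : ∀ {x y} → x < n → y < n → Live x → Live y → g x ≢ g y → f x ≢ f y
      describes-≢ x<n y<n x-live y-live gx≢gy fx≡fy = gx≢gy (Equivalence.to (sameClass x<n y<n x-live y-live) fx≡fy)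

      private
        together : ∀ {h₁ h₂ : ℕ → L} → (∀ {u v} → u < n → v < n → Live u → Live v → h₁ u ≡ h₁ v → h₂ u ≡ h₂ v) →
          ∀ {a b x y} → a < n → b < n → x < n → y < n → Live a → Live b → Live x → Live y →
          ContractedTogether h₁ a b x y → ContractedTogether h₂ a b x y
        together h₁⇒h₂ a<n b<n x<n y<n a-live b-live x-live y-live (inj₁ e) = inj₁ (h₁⇒h₂ x<n y<n x-live y-live e)
        together {h₁} {h₂} h₁⇒h₂ {a} {b} a<n b<n x<n y<n a-live b-live x-live y-live (inj₂ (x∈ab , y∈ab)) =
          inj₂ (end x<n x-live x∈ab , end y<n y-live y∈ab)
          where
          end : ∀ {z} → z < n → Live z → EndClass h₁ a b z → EndClass h₂ a b z
          end z<n z-live (inj₁ e) = inj₁ (h₁⇒h₂ z<n a<n z-live a-live e)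
          end z<n z-live (inj₂ e) = inj₂ (h₁⇒h₂ z<n b<n z-live b-live e)

        f⇒g : ∀ {u v} → u < n → v < n → Live u → Live v → f u ≡ f v → g u ≡ g v
        f⇒g u<n v<n u-live v-live = Equivalence.to (sameClass u<n v<n u-live v-live)
        g⇒f : ∀ {u v} → u < n → v < n → Live u → Live v → g u ≡ g v → f u ≡ f v
        g⇒f u<n v<n u-live v-live = Equivalence.from (sameClass u<n v<n u-live v-live)

        cover-contract : ∀ {a b x} → x < n → Σ ℕ λ y → y < n × Live y × contract f a b x ≡ contract f a b y
        cover-contract x<n = let (y , y<n , y-live , e) = cover x<n in y , y<n , y-live , contract-cong f _ _ e

      describes-contract : ∀ {a b} → a < n → b < n → Live a → Live b →
                           Describes (contract f a b) (contract g a b) Live n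
      describes-contract {a} {b} a<n b<n a-live b-live = record
        { sameClass = λ x<n y<n x-live y-live → mk⇔
            (λ e → contract-≡⁺ g a b (together f⇒g a<n b<n x<n y<n a-live b-live x-live y-live (contract-≡⁻ f a b e)))
            (λ e → contract-≡⁺ f a b (together g⇒f a<n b<n x<n y<n a-live b-live x-live y-live (contract-≡⁻ g a b e)))
        ; cover = cover-contract }

      describes-contract-swap : ∀ {a b} → a < n → b < n → Live a → Live b →
                                Describes (contract f a b) (contract g b a) Live n
      describes-contract-swap {a} {b} a<n b<n a-live b-live = record
        { sameClass = λ x<n y<n x-live y-live → mk⇔
            (λ e → contract-≡⁺ g b a (ContractedTogether-swap g a b
                     (together f⇒g a<n b<n x<n y<n a-live b-live x-live y-live (contract-≡⁻ f a b e))))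
            (λ e → contract-≡⁺ f a b (together g⇒f a<n b<n x<n y<n a-live b-live x-live y-live
                     (ContractedTogether-swap g b a (contract-≡⁻ g b a e))))
        ; cover = cover-contract }

      describes-restrict : ∀ {g' : ℕ → L} {Live' : ℕ → Set} → (∀ {x} → x < n → Live' x → Live x) →
        (∀ {x} → x < n → Live' x → g x ≡ g' x) →
        (∀ {x} → x < n → Live x → Σ ℕ λ y → y < n × Live' y × g x ≡ g y) → Describes f g' Live' n
      describes-restrict {g'} shrink agree cover' = record
        { sameClass = λ {x} {y} x<n y<n x-live y-live →
            let x-live' = shrink x<n x-live ; y-live' = shrink y<n y-live in mk⇔
            (λ e → trans (sym (agree x<n x-live)) (trans (f⇒g x<n y<n x-live' y-live' e) (agree y<n y-live)))
            (λ e → g⇒f x<n y<n x-live' y-live' (trans (agree x<n x-live) (trans e (sym (agree y<n y-live)))))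
        ; cover = λ x<n → let (y , y<n , y-live , e) = cover x<n
                              (z , z<n , z-live , e') = cover' y<n y-live in
                          z , z<n , z-live , trans e (g⇒f y<n z<n y-live (shrink z<n z-live) e') }

module Bridge where

  open import Defs using (Multigraph; Joins; Walk; done; step; IsSpanningTree; Connected; Acyclic)
  open LabelledGraphs using (module Graph)
  open import Data.Nat using (ℕ; suc; _<_)
  open import Data.List.Relation.Unary.Unique.Propositional using (Unique)
  open import Data.Fin using (Fin; toℕ; fromℕ<)
  open import Data.Fin.Properties using (toℕ<n; toℕ-fromℕ<)
  open import Data.List using (List; []; _∷_; length; lookup)
  open import Data.Product using (_×_; _,_; Σ)
  open import Relation.Binary.Definitions using (DecidableEquality)
  open import Relation.Binary.PropositionalEquality using (_≡_; refl; sym; trans; cong; subst; subst₂)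
  open import Function.Bundles using (_⇔_; mk⇔)

  -- G is presented as the image of Fin (suc N) under φ, the identifications
  -- made by φ being recorded by the labelling ψ.
  module _ {N n' : ℕ} (G : Multigraph n') (φ : Fin (suc N) → Fin n')
           {L : Set} (_≟L_ : DecidableEquality L) (ψ : ℕ → L)
           (ends : Fin (length G) → ℕ × ℕ)
           (ends-lift : ∀ e → Σ (Fin (suc N)) λ â → Σ (Fin (suc N)) λ b̂ →
                          lookup G e ≡ (φ â , φ b̂) × ends e ≡ (toℕ â , toℕ b̂))
           (φ⇒ψ : ∀ x̂ ŷ → φ x̂ ≡ φ ŷ → ψ (toℕ x̂) ≡ ψ (toℕ ŷ))
           (ψ⇒φ : ∀ x̂ ŷ → ψ (toℕ x̂) ≡ ψ (toℕ ŷ) → φ x̂ ≡ φ ŷ)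
           (φ-surjective : ∀ u → Σ (Fin (suc N)) λ x̂ → φ x̂ ≡ u) where

    open Graph (length G) ends _≟L_ using (fwd; bwd; startAt; endAt)
      renaming (Walk to Walkᴸ; done to doneᴸ; step to stepᴸ; SpanningTree to SpanningTreeᴸ)
    open import Data.Fin.Subset using () renaming (_∈_ to _∈ₛ_)

    private
      ,-injective : ∀ {A B : Set} {a a' : A} {b b' : B} → (a , b) ≡ (a' , b') → a ≡ a' × b ≡ b'
      ,-injective refl = refl , refl

    walk-image : ∀ {S x y es} → Walkᴸ ψ (_∈ₛ S) x y es → ∀ x̂ ŷ → x ≡ toℕ x̂ → y ≡ toℕ ŷ → Walk G S (φ x̂) (φ ŷ) es
    walk-image (doneᴸ e) x̂ ŷ refl refl = subst (λ v → Walk G _ (φ x̂) v []) (ψ⇒φ x̂ ŷ e) done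
    walk-image (stepᴸ d d∈S (fwd ends≡) e w) x̂ ŷ refl refl with ends-lift d
    ... | â , b̂ , lookup≡ , ends≡' with ,-injective (trans (sym ends≡) ends≡')
    ... | refl , refl = step d d∈S (Joins.fwd (trans lookup≡ (cong (_, φ b̂) (sym (ψ⇒φ x̂ â e)))))
                          (walk-image w b̂ ŷ refl refl)
    walk-image (stepᴸ d d∈S (bwd ends≡) e w) x̂ ŷ refl refl with ends-lift d
    ... | â , b̂ , lookup≡ , ends≡' with ,-injective (trans (sym ends≡) ends≡')
    ... | refl , refl = step d d∈S (Joins.bwd (trans lookup≡ (cong (φ â ,_) (sym (ψ⇒φ x̂ b̂ e)))))
                          (walk-image w â ŷ refl refl)

    walk-preimage : ∀ {S u v es} → Walk G S u v es → ∀ x̂ ŷ → φ x̂ ≡ u → φ ŷ ≡ v → Walkᴸ ψ (_∈ₛ S) (toℕ x̂) (toℕ ŷ) es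
    walk-preimage done x̂ ŷ refl e = doneᴸ (φ⇒ψ x̂ ŷ (sym e))
    walk-preimage (step d d∈S (Joins.fwd lookup≡) w) x̂ ŷ refl e with ends-lift d
    ... | â , b̂ , lookup≡' , ends≡ with ,-injective (trans (sym lookup≡) lookup≡')
    ... | e₁ , e₂ = stepᴸ d d∈S (fwd ends≡) (φ⇒ψ x̂ â e₁) (walk-preimage w b̂ ŷ (sym e₂) e)
    walk-preimage (step d d∈S (Joins.bwd lookup≡) w) x̂ ŷ refl e with ends-lift d
    ... | â , b̂ , lookup≡' , ends≡ with ,-injective (trans (sym lookup≡) lookup≡')
    ... | e₁ , e₂ = stepᴸ d d∈S (bwd ends≡) (φ⇒ψ x̂ b̂ e₂) (walk-preimage w â ŷ (sym e₁) e)

    closed-walk-image : ∀ {S x d es} → Walkᴸ ψ (_∈ₛ S) x x (d ∷ es) → Σ (Fin n') λ u → Walk G S u u (d ∷ es)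
    closed-walk-image (stepᴸ d d∈S (fwd ends≡) e w) with ends-lift d
    ... | â , b̂ , _ , ends≡' with ,-injective (trans (sym ends≡) ends≡')
    ... | refl , refl = φ â , walk-image (endAt e (stepᴸ d d∈S (fwd ends≡) refl w)) â â refl refl
    closed-walk-image (stepᴸ d d∈S (bwd ends≡) e w) with ends-lift d
    ... | â , b̂ , _ , ends≡' with ,-injective (trans (sym ends≡) ends≡')
    ... | refl , refl = φ b̂ , walk-image (endAt e (stepᴸ d d∈S (bwd ends≡) refl w)) b̂ b̂ refl refl

    IsSpanningTree⇔ : ∀ S → IsSpanningTree G S ⇔ SpanningTreeᴸ ψ (_∈ₛ S) (suc N)
    IsSpanningTree⇔ S = mk⇔ to from
      where
      to : IsSpanningTree G S → SpanningTreeᴸ ψ (_∈ₛ S) (suc N)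
      to (connected , acyclic) = connectedᴸ , acyclicᴸ
        where
        connectedᴸ : ∀ x y → x < suc N → y < suc N → Σ (List _) (Walkᴸ ψ (_∈ₛ S) x y)
        connectedᴸ x y x< y< =
          let (es , w) = connected (φ (fromℕ< x<)) (φ (fromℕ< y<))
              w' = walk-preimage w (fromℕ< x<) (fromℕ< y<) refl refl in
          es , subst₂ (λ a b → Walkᴸ ψ (_∈ₛ S) a b es) (toℕ-fromℕ< x<) (toℕ-fromℕ< y<) w'
        acyclicᴸ : ∀ x es → Walkᴸ ψ (_∈ₛ S) x x es → Unique es → es ≡ []
        acyclicᴸ x [] w u = refl
        acyclicᴸ x (d ∷ es) w u = let (v , w') = closed-walk-image w in acyclic v (d ∷ es) w' u
      from : SpanningTreeᴸ ψ (_∈ₛ S) (suc N) → IsSpanningTree G S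
      from (connected , acyclic) = connected' , acyclic'
        where
        connected' : Connected G S
        connected' u v with φ-surjective u | φ-surjective v
        ... | x̂ , refl | ŷ , refl =
          let (es , w) = connected (toℕ x̂) (toℕ ŷ) (toℕ<n x̂) (toℕ<n ŷ) in es , walk-image w x̂ ŷ refl refl
        acyclic' : Acyclic G S
        acyclic' u es w u-unique with φ-surjective u
        ... | x̂ , refl = acyclic (toℕ x̂) es (walk-preimage w x̂ x̂ refl refl) u-unique

module Transfer where

  open Auxiliary using (relabel; relabel-≡; relabel-≢)
  open import Data.Nat using (ℕ; zero; suc; _<_; _≤_; _+_; _∸_; _%_; _≟_; _<?_; z≤n; s≤s)
  open import Data.Nat.DivMod using (_mod_; m<n⇒m%n≡m; n%n≡0; m%n<n)
  open import Data.Fin using (Fin; toℕ; cast)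
  open import Data.Fin.Properties using (toℕ-cast; toℕ-fromℕ<; toℕ-injective; toℕ<n)
  open import Data.List using (List; []; _∷_)
  open import Data.List.Membership.Propositional using (_∈_; _∉_)
  open import Data.List.Relation.Unary.Any using (here; there)
  open import Data.Nat.Properties as ℕ using ()
  open import Data.Bool using (true; false; if_then_else_)
  open import Data.Product using (_×_; _,_; Σ; proj₁; proj₂)
  open import Data.Sum using (_⊎_; inj₁; inj₂)
  open import Data.Empty using (⊥-elim)
  open import Relation.Nullary using (¬_; Dec; yes; no; does)
  open import Relation.Nullary.Decidable using (dec-true; dec-false)
  open import Relation.Binary.Definitions using (DecidableEquality; tri<; tri≈; tri>)
  open import Relation.Binary.PropositionalEquality using (_≡_; _≢_; refl; sym; trans; cong; subst)
  open import Function using (_∘_; case_of_)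
  open import Data.Fin.Subset using () renaming (_∈_ to _∈ₛ_)

  does-true⇒ : ∀ {A : Set} (a? : Dec A) → does a? ≡ true → A
  does-true⇒ (yes a) _ = a

  does-false⇒¬ : ∀ {A : Set} (a? : Dec A) → does a? ≡ false → ¬ A
  does-false⇒¬ (no ¬a) _ = ¬a

  data Label : Set where
    hub root : Label
    own : ℕ → Label

  own-injective : ∀ {x y} → own x ≡ own y → x ≡ y
  own-injective refl = refl

  _≟ᴸ_ : DecidableEquality Label
  hub ≟ᴸ hub = yes refl
  hub ≟ᴸ root = no λ ()
  hub ≟ᴸ own _ = no λ ()
  root ≟ᴸ hub = no λ ()
  root ≟ᴸ root = yes refl
  root ≟ᴸ own _ = no λ ()
  own _ ≟ᴸ hub = no λ ()
  own _ ≟ᴸ root = no λ ()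
  own x ≟ᴸ own y with x ≟ y
  ... | yes refl = yes refl
  ... | no x≢y = no (x≢y ∘ own-injective)

  -- The component of the root v₀ = v_ℓ (apart from the hub or joined to it)
  -- and that of the last processed rim vertex (the hub's, the root's or its own).
  data State : Set where
    apart-hub apart-root apart-own joined-hub joined-own : State

  rootLabel : State → Label
  rootLabel apart-hub = root
  rootLabel apart-root = root
  rootLabel apart-own = root
  rootLabel joined-hub = hub
  rootLabel joined-own = hub

  prevLabel : State → ℕ → Label
  prevLabel apart-hub i = hub
  prevLabel apart-root i = root
  prevLabel apart-own i = own (i ∸ 1)
  prevLabel joined-hub i = hub
  prevLabel joined-own i = own (i ∸ 1)

  -- Deletion–contraction of the rim edge v_{i-1}v_i and then of the spoke at v_i,
  -- for v_i a fresh vertex (freshStep) or the root (rootStep); a summand 0 is a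
  -- branch in which v_{i-1} gets cut off.
  freshStep : (State → ℕ) → State → ℕ
  freshStep v joined-hub = (v joined-own + v joined-hub) + v joined-hub
  freshStep v joined-own = 0 + (v joined-own + v joined-hub)
  freshStep v apart-hub = (v apart-own + v apart-hub) + v apart-hub
  freshStep v apart-own = 0 + (v apart-own + v apart-hub)
  freshStep v apart-root = (v apart-own + v apart-hub) + (v apart-root + v joined-hub)

  rootStep : (State → ℕ) → State → ℕ
  rootStep v apart-hub = (v apart-root + v joined-hub) + v joined-hub
  rootStep v apart-root = v apart-root + v joined-hub
  rootStep v apart-own = 0 + (v apart-root + v joined-hub)
  rootStep v joined-hub = v joined-hub
  rootStep v joined-own = 0 + v joined-hub

  final : State → ℕ
  final apart-hub = 0
  final apart-root = 0
  final apart-own = 0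
  final joined-hub = 1
  final joined-own = 1

  module Wheel (n ℓ : ℕ) (ℓ<N : ℓ < suc n) where

    N : ℕ
    N = suc n

    ℓ≢N : ℓ ≢ N
    ℓ≢N ℓ≡N = ℕ.<-irrefl ℓ≡N ℓ<N

    -- The labelling when v_i is next to be processed: the root v₀ = v_ℓ gets r,
    -- v_{i-1} gets lp, v_i gets li, the hub gets hub and every later vertex is a
    -- singleton.  The processed vertices are no longer live; hub is a junk value.
    layout : ℕ → Label → Label → Label → ℕ → Label
    layout i r lp li x =
      if does (x ≟ 0) then r else
      if does (x ≟ ℓ) then r else
      if does (x ≟ N) then hub else
      if does (suc x <? i) then hub else
      if does (suc x ≟ i) then lp else
      if does (x ≟ i) then li else own x

    module _ {i : ℕ} {r lp li : Label} where

      layout-ℓ : layout i r lp li ℓ ≡ r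
      layout-ℓ with does (ℓ ≟ 0)
      ... | true = refl
      ... | false rewrite dec-true (ℓ ≟ ℓ) refl = refl

      layout-N : layout i r lp li N ≡ hub
      layout-N rewrite dec-false (N ≟ ℓ) (ℓ≢N ∘ sym) | dec-true (N ≟ N) refl = refl

      layout-prev : ∀ {x} → suc x ≡ i → x ≢ 0 → x ≢ ℓ → x ≢ N → layout i r lp li x ≡ lp
      layout-prev {x} refl x≢0 x≢ℓ x≢N
        rewrite dec-false (x ≟ 0) x≢0 | dec-false (x ≟ ℓ) x≢ℓ | dec-false (x ≟ N) x≢N
              | dec-false (suc x <? suc x) (ℕ.<-irrefl refl) | dec-true (suc x ≟ suc x) refl = refl

      layout-cur : ∀ {x} → x ≡ i → x ≢ 0 → x ≢ ℓ → x ≢ N → layout i r lp li x ≡ li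
      layout-cur {x} refl x≢0 x≢ℓ x≢N
        rewrite dec-false (x ≟ 0) x≢0 | dec-false (x ≟ ℓ) x≢ℓ | dec-false (x ≟ N) x≢N
              | dec-false (suc x <? x) (ℕ.<-asym (ℕ.n<1+n x)) | dec-false (suc x ≟ x) (ℕ.1+n≢n)
              | dec-true (x ≟ x) refl = refl

      layout-later : ∀ {x} → i < x → x ≢ 0 → x ≢ ℓ → x ≢ N → layout i r lp li x ≡ own x
      layout-later {x} i<x x≢0 x≢ℓ x≢N
        rewrite dec-false (x ≟ 0) x≢0 | dec-false (x ≟ ℓ) x≢ℓ | dec-false (x ≟ N) x≢N
              | dec-false (suc x <? i) (λ x<i → ℕ.<-asym i<x (ℕ.<-trans (ℕ.n<1+n x) x<i))
              | dec-false (suc x ≟ i) (λ x+1≡i → ℕ.<-asym i<x (subst (x <_) x+1≡i (ℕ.n<1+n x)))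
              | dec-false (x ≟ i) (λ x≡i → ℕ.<-irrefl (sym x≡i) i<x) = refl

      layout-relabel : ∀ t s → relabel _≟ᴸ_ t s hub ≡ hub → (∀ x → i < x → relabel _≟ᴸ_ t s (own x) ≡ own x) →
        ∀ x → relabel _≟ᴸ_ t s (layout i r lp li x)
            ≡ layout i (relabel _≟ᴸ_ t s r) (relabel _≟ᴸ_ t s lp) (relabel _≟ᴸ_ t s li) x
      layout-relabel t s hub-fixed later-fixed x with does (x ≟ 0)
      ... | true = refl
      ... | false with does (x ≟ ℓ)
      ... | true = refl
      ... | false with does (x ≟ N)
      ... | true = hub-fixed
      ... | false with does (suc x <? i) in x+1≮i
      ... | true = hub-fixed
      ... | false with does (suc x ≟ i) in x+1≢i
      ... | true = refl
      ... | false with does (x ≟ i) in x≢i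
      ... | true = refl
      ... | false = later-fixed x i<x
        where
        i≤x : i ≤ x
        i≤x = ℕ.≤-pred (ℕ.≤∧≢⇒< (ℕ.≮⇒≥ (does-false⇒¬ (suc x <? i) x+1≮i)) (does-false⇒¬ (suc x ≟ i) x+1≢i ∘ sym))
        i<x : i < x
        i<x = ℕ.≤∧≢⇒< i≤x (does-false⇒¬ (x ≟ i) x≢i ∘ sym)

      layout-advance : ∀ {lp'} x → (x ≡ 0 ⊎ i ≤ x) → (i ≢ ℓ → i ≢ N → li ≡ lp') →
                       layout i r lp li x ≡ layout (suc i) r lp' (own (suc i)) x
      layout-advance .0 (inj₁ refl) li≡lp' = refl
      layout-advance x (inj₂ i≤x) li≡lp' with does (x ≟ 0)
      ... | true = refl
      ... | false with does (x ≟ ℓ) in x≢ℓ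
      ... | true = refl
      ... | false with does (x ≟ N) in x≢N
      ... | true = refl
      ... | false
        rewrite dec-false (suc x <? i) (λ x+1<i → ℕ.<-irrefl refl (ℕ.<-≤-trans x+1<i (ℕ.m≤n⇒m≤1+n i≤x)))
              | dec-false (suc x ≟ i) (λ x+1≡i → ℕ.<-irrefl (sym x+1≡i) (s≤s i≤x))
              | dec-false (suc x <? suc i) (ℕ.≤⇒≯ (s≤s i≤x))
        with does (x ≟ i) in x≟i
      ... | true = li≡lp' (λ i≡ℓ → does-false⇒¬ (x ≟ ℓ) x≢ℓ (trans x≡i i≡ℓ))
                          (λ i≡N → does-false⇒¬ (x ≟ N) x≢N (trans x≡i i≡N))
        where
        x≡i : x ≡ i
        x≡i = does-true⇒ (x ≟ i) x≟i
      ... | false with does (x ≟ suc i) in x≟i+1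
      ... | true = cong own (does-true⇒ (x ≟ suc i) x≟i+1)
      ... | false = refl

    -- Stage i processes the rim edge v_{i-1}v_i and the spoke at v_{i mod N},
    -- so stage N closes the rim at v₀.
    IsRoot : ℕ → Set
    IsRoot i = i ≡ ℓ ⊎ i ≡ N

    step : ℕ → (State → ℕ) → State → ℕ
    step i with i ≟ ℓ | i ≟ N
    ... | no _ | no _ = freshStep
    ... | _ | _ = rootStep

    step-root : ∀ {i} → IsRoot i → step i ≡ rootStep
    step-root {i} isRoot with i ≟ ℓ | i ≟ N
    ... | yes _ | _ = refl
    ... | no _ | yes _ = refl
    ... | no i≢ℓ | no i≢N = ⊥-elim ([ i≢ℓ , i≢N ]′ isRoot)
      where open Data.Sum using ([_,_]′)

    step-fresh : ∀ {i} → i ≢ ℓ → i ≢ N → step i ≡ freshStep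
    step-fresh {i} i≢ℓ i≢N with i ≟ ℓ | i ≟ N
    ... | yes i≡ℓ | _ = ⊥-elim (i≢ℓ i≡ℓ)
    ... | no _ | yes i≡N = ⊥-elim (i≢N i≡N)
    ... | no _ | no _ = refl

    count : ℕ → ℕ → State → ℕ
    count i zero = final
    count i (suc k) = step i (count (suc i) k)

    count-root : ∀ {i} k σ → IsRoot i → count i (suc k) σ ≡ rootStep (count (suc i) k) σ
    count-root k σ isRoot = cong (λ s → s (count _ k) σ) (step-root isRoot)

    count-fresh : ∀ {i} k σ → i ≢ ℓ → i ≢ N → count i (suc k) σ ≡ freshStep (count (suc i) k) σ
    count-fresh k σ i≢ℓ i≢N = cong (λ s → s (count _ k) σ) (step-fresh i≢ℓ i≢N)

    stateLayout : ℕ → State → ℕ → Label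
    stateLayout i σ = layout i (rootLabel σ) (prevLabel σ i) (own i)

    Consistent : ℕ → State → Set
    Consistent i σ = (i ∸ 1 ≡ 0 ⊎ i ∸ 1 ≡ ℓ) → prevLabel σ i ≡ rootLabel σ

    Live : ℕ → ℕ → Set
    Live i x = x ≡ 0 ⊎ i ≤ suc x

    -- Edge k < N is the rim edge v_k v_{k+1} and edge N + t the spoke v_t v_N;
    -- the reduction mod N + N in `edge` only makes it total.
    wheelEnds : ℕ → ℕ × ℕ
    wheelEnds k = if does (k <? N) then (k , suc k % N) else (k ∸ N , N)

    wheelEnds-rim : ∀ {k} → k < N → wheelEnds k ≡ (k , suc k % N)
    wheelEnds-rim {k} k<N rewrite dec-true (k <? N) k<N = refl

    wheelEnds-spoke : ∀ t → wheelEnds (N + t) ≡ (t , N)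
    wheelEnds-spoke t rewrite dec-false (N + t <? N) (λ lt → ℕ.<-irrefl refl (ℕ.<-≤-trans lt (ℕ.m≤m+n N t))) =
      cong (_, N) (ℕ.m+n∸m≡n N t)

    module Edges (m : ℕ) (m≡ : N + N ≡ m) where

      ends : Fin m → ℕ × ℕ
      ends e = wheelEnds (toℕ e)

      edge : ℕ → Fin m
      edge k = cast m≡ (k mod (N + N))

      toℕ-edge : ∀ {k} → k < N + N → toℕ (edge k) ≡ k
      toℕ-edge {k} k< = trans (toℕ-cast m≡ (k mod (N + N))) (trans (toℕ-fromℕ< _) (m<n⇒m%n≡m k<))

      edge-injective : ∀ {x y} → x < N + N → y < N + N → edge x ≡ edge y → x ≡ y
      edge-injective x< y< e = trans (sym (toℕ-edge x<)) (trans (cong toℕ e) (toℕ-edge y<))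

      rim<N+N : ∀ {k} → k < N → k < N + N
      rim<N+N k<N = ℕ.<-≤-trans k<N (ℕ.m≤m+n N N)

      spoke<N+N : ∀ t → N + t % N < N + N
      spoke<N+N t = ℕ.+-monoʳ-< N (m%n<n t N)

      ends-rim : ∀ {k} → k < N → ends (edge k) ≡ (k , suc k % N)
      ends-rim k<N = trans (cong wheelEnds (toℕ-edge (rim<N+N k<N))) (wheelEnds-rim k<N)

      ends-spoke : ∀ t → ends (edge (N + t % N)) ≡ (t % N , N)
      ends-spoke t = trans (cong wheelEnds (toℕ-edge (spoke<N+N t))) (wheelEnds-spoke (t % N))

      schedule : ℕ → ℕ → List (Fin m)
      schedule i zero = []
      schedule i (suc k) = edge (i ∸ 1) ∷ edge (N + i % N) ∷ schedule (suc i) k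

      ∈-schedule⁻ : ∀ i k {d} → d ∈ schedule i k →
        Σ ℕ λ t → i ≤ t × t < i + k × (d ≡ edge (t ∸ 1) ⊎ d ≡ edge (N + t % N))
      ∈-schedule⁻ i (suc k) (here refl) = i , ℕ.≤-refl , ℕ.m<m+n i (s≤s z≤n) , inj₁ refl
      ∈-schedule⁻ i (suc k) (there (here refl)) = i , ℕ.≤-refl , ℕ.m<m+n i (s≤s z≤n) , inj₂ refl
      ∈-schedule⁻ i (suc k) (there (there d∈)) =
        let (t , i<t , t< , d≡) = ∈-schedule⁻ (suc i) k d∈ in
        t , ℕ.<⇒≤ i<t , subst (t <_) (sym (ℕ.+-suc i k)) t< , d≡

      Upcoming : ℕ → ℕ → Set
      Upcoming i a = a ≡ 0 ⊎ i ≤ a × a ≤ N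

      upcoming-% : ∀ {i t} → i ≤ t → t ≤ N → Upcoming i (t % N)
      upcoming-% {i} {t} i≤t t≤N with ℕ.m≤n⇒m<n∨m≡n t≤N
      ... | inj₁ t<N rewrite m<n⇒m%n≡m t<N = inj₂ (i≤t , t≤N)
      ... | inj₂ refl = inj₁ (n%n≡0 N)

      stage≤N : ∀ {i k} → i + suc k ≡ suc N → i ≤ N
      stage≤N {i} eq = ℕ.≤-pred (subst (suc i ≤_) eq (ℕ.m<m+n i (s≤s z≤n)))

      scheduled≤N : ∀ {i k t} → i + suc k ≡ suc N → t < suc i + k → t ≤ N
      scheduled≤N {i} {k} {t} eq t< = ℕ.≤-pred (subst (t <_) (trans (sym (ℕ.+-suc i k)) eq) t<)

      private
        ,-injective : ∀ {A B : Set} {a a' : A} {b b' : B} → (a , b) ≡ (a' , b') → a ≡ a' × b ≡ b'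
        ,-injective refl = refl , refl

      upcoming-rim : ∀ {i t a b} → suc i ≤ t → t ≤ N → ends (edge (t ∸ 1)) ≡ (a , b) → Upcoming i a × Upcoming i b
      upcoming-rim {i} {suc t} (s≤s i≤t) t<N ends≡ with ,-injective (trans (sym ends≡) (ends-rim t<N))
      ... | refl , refl = inj₂ (i≤t , ℕ.≤-trans (ℕ.n≤1+n t) t<N) , upcoming-% (ℕ.≤-trans (ℕ.n≤1+n i) (s≤s i≤t)) t<N

      upcoming-spoke : ∀ {i t a b} → i ≤ t → t ≤ N → ends (edge (N + t % N)) ≡ (a , b) → Upcoming i a × Upcoming i b
      upcoming-spoke {t = t} i≤t t≤N ends≡ with ,-injective (trans (sym ends≡) (ends-spoke t))
      ... | refl , refl = upcoming-% i≤t t≤N , inj₂ (ℕ.≤-trans i≤t t≤N , ℕ.≤-refl)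

      upcoming-ends : ∀ {i k d a b} → i + suc k ≡ suc N → d ∈ edge (N + i % N) ∷ schedule (suc i) k →
                      ends d ≡ (a , b) → Upcoming i a × Upcoming i b
      upcoming-ends eq (here refl) ends≡ = upcoming-spoke ℕ.≤-refl (stage≤N eq) ends≡
      upcoming-ends {i} {k} eq (there d∈) ends≡ with ∈-schedule⁻ (suc i) k d∈
      ... | t , i<t , t< , inj₁ refl = upcoming-rim i<t (scheduled≤N eq t<) ends≡
      ... | t , i<t , t< , inj₂ refl = upcoming-spoke (ℕ.<⇒≤ i<t) (scheduled≤N eq t<) ends≡

      rim∉schedule : ∀ {i k} → 1 ≤ i → i + suc k ≡ suc N → edge (i ∸ 1) ∉ edge (N + i % N) ∷ schedule (suc i) k
      rim∉schedule {suc i} {k} _ eq (here e) =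
        ℕ.<-irrefl (edge-injective (rim<N+N (stage≤N eq)) (spoke<N+N (suc i)) e) (ℕ.<-≤-trans (stage≤N eq) (ℕ.m≤m+n N _))
      rim∉schedule {suc i} {k} _ eq (there d∈) with ∈-schedule⁻ (suc (suc i)) k d∈
      ... | suc t , s≤s i<t , t< , inj₁ e =
        ℕ.<-irrefl (edge-injective (rim<N+N (stage≤N eq)) (rim<N+N (scheduled≤N {suc i} {k} eq t<)) e) i<t
      ... | t , i<t , t< , inj₂ e =
        ℕ.<-irrefl (edge-injective (rim<N+N (stage≤N eq)) (spoke<N+N t) e) (ℕ.<-≤-trans (stage≤N eq) (ℕ.m≤m+n N _))

      spoke∉schedule : ∀ {i k} → 1 ≤ i → i + suc k ≡ suc N → edge (N + i % N) ∉ schedule (suc i) k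
      spoke∉schedule {i} {k} 1≤i eq d∈ with ∈-schedule⁻ (suc i) k d∈
      ... | suc t , s≤s i≤t , t< , inj₁ e =
        ℕ.<-irrefl refl (ℕ.<-≤-trans (subst (_< N) (sym (edge-injective (spoke<N+N i) (rim<N+N t<N) e)) t<N) (ℕ.m≤m+n N _))
        where
        t<N : t < N
        t<N = scheduled≤N eq t<
      ... | t , i<t , t< , inj₂ e with ℕ.m≤n⇒m<n∨m≡n (scheduled≤N eq t<)
      ... | inj₁ t<N = ℕ.<-irrefl (trans (sym (m<n⇒m%n≡m i<N)) (trans i%≡t% (m<n⇒m%n≡m t<N))) i<t
        where
        i%≡t% : i % N ≡ t % N
        i%≡t% = ℕ.+-cancelˡ-≡ N _ _ (edge-injective (spoke<N+N i) (spoke<N+N t) e)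
        i<N : i < N
        i<N = ℕ.<-trans (ℕ.n<1+n i) (ℕ.≤-<-trans i<t t<N)
      ... | inj₂ refl = ℕ.<-irrefl (sym (trans (sym (m<n⇒m%n≡m i<N)) (trans i%≡t% (n%n≡0 N)))) 1≤i
        where
        i%≡t% : i % N ≡ t % N
        i%≡t% = ℕ.+-cancelˡ-≡ N _ _ (edge-injective (spoke<N+N i) (spoke<N+N t) e)
        i<N : i < N
        i<N = ℕ.<-≤-trans i<t ℕ.≤-refl

      open LabelledGraphs.Graph m ends _≟ᴸ_ public

      private
        rl : Label → Label → Label → Label
        rl = relabel _≟ᴸ_

      CountCorrect : ℕ → ℕ → Set
      CountCorrect i k = ∀ σ f → Consistent i σ → Describes f (stateLayout i σ) (Live i) (suc N) →
                   TreeCount f (schedule i k) (suc N) (count i k σ)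

      module Stage {i : ℕ} (1≤i : 1 ≤ i) (i≤N : i ≤ N) where

        prev : ℕ
        prev = i ∸ 1

        suc-prev : suc prev ≡ i
        suc-prev = ℕ.m+[n∸m]≡n 1≤i

        prev<N : prev < N
        prev<N = subst (_≤ N) (sym suc-prev) i≤N

        root< : 0 < suc N
        root< = s≤s z≤n

        prev< : prev < suc N
        prev< = ℕ.<-trans prev<N (ℕ.n<1+n N)

        cur< : i < suc N
        cur< = s≤s i≤N

        hub< : N < suc N
        hub< = ℕ.n<1+n N

        live-prev : Live i prev
        live-prev = inj₂ (ℕ.≤-reflexive (sym suc-prev))

        live-cur : Live i i
        live-cur = inj₂ (ℕ.n≤1+n i)

        live-hub : Live i N
        live-hub = inj₂ (ℕ.≤-trans i≤N (ℕ.n≤1+n N))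

        i≢0 : i ≢ 0
        i≢0 i≡0 = ℕ.<-irrefl (sym i≡0) 1≤i

        layout-at-prev : ∀ {r lp li} → (prev ≡ 0 ⊎ prev ≡ ℓ → lp ≡ r) → layout i r lp li prev ≡ lp
        layout-at-prev {r} {lp} {li} consistent with prev ≟ 0 | prev ≟ ℓ
        ... | yes prev≡0 | _ = trans (cong (layout i r lp li) prev≡0) (sym (consistent (inj₁ prev≡0)))
        ... | no _ | yes prev≡ℓ =
          trans (cong (layout i r lp li) prev≡ℓ) (trans (layout-ℓ {i} {r} {lp} {li}) (sym (consistent (inj₂ prev≡ℓ))))
        ... | no prev≢0 | no prev≢ℓ = layout-prev suc-prev prev≢0 prev≢ℓ (λ prev≡N → ℕ.<-irrefl prev≡N prev<N)

        layout-at-cur : ∀ {r lp li} → i ≢ ℓ → i ≢ N → layout i r lp li i ≡ li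
        layout-at-cur i≢ℓ i≢N = layout-cur refl i≢0 i≢ℓ i≢N

        describes-layout-contract : ∀ {f r lp li a b la lb} → Describes f (layout i r lp li) (Live i) (suc N) →
          a < suc N → b < suc N → Live i a → Live i b → layout i r lp li a ≡ la → layout i r lp li b ≡ lb →
          rl lb la hub ≡ hub → (∀ x → i < x → rl lb la (own x) ≡ own x) →
          Describes (contract f a b) (layout i (rl lb la r) (rl lb la lp) (rl lb la li)) (Live i) (suc N)
        describes-layout-contract desc a< b< a-live b-live refl refl hub-fixed later-fixed =
          describes-restrict (describes-contract desc a< b< a-live b-live) (λ _ live → live)
            (λ {x} _ _ → layout-relabel _ _ hub-fixed later-fixed x) (λ {x} x< live → x , x< , live , refl)

        describes-layout-contract-swap : ∀ {f r lp li a b la lb} → Describes f (layout i r lp li) (Live i) (suc N) →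
          a < suc N → b < suc N → Live i a → Live i b → layout i r lp li a ≡ la → layout i r lp li b ≡ lb →
          rl la lb hub ≡ hub → (∀ x → i < x → rl la lb (own x) ≡ own x) →
          Describes (contract f a b) (layout i (rl la lb r) (rl la lb lp) (rl la lb li)) (Live i) (suc N)
        describes-layout-contract-swap desc a< b< a-live b-live refl refl hub-fixed later-fixed =
          describes-restrict (describes-contract-swap desc a< b< a-live b-live) (λ _ live → live)
            (λ {x} _ _ → layout-relabel _ _ hub-fixed later-fixed x) (λ {x} x< live → x , x< , live , refl)

        -- Advancing to stage i + 1 forgets v_{i-1}, so its class must contain a vertex live at stage i + 1.
        describes-layout-advance : ∀ {f r lp li lp'} → Describes f (layout i r lp li) (Live i) (suc N) →
          (i ≢ ℓ → i ≢ N → li ≡ lp') →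
          (Σ ℕ λ y → y < suc N × Live (suc i) y × layout i r lp li prev ≡ layout i r lp li y) →
          Describes f (layout (suc i) r lp' (own (suc i))) (Live (suc i)) (suc N)
        describes-layout-advance {f} {r} {lp} {li} {lp'} desc li≡lp' (y , y< , y-live , prev≡y) =
          describes-restrict desc shrink agree cover
          where
          shrink : ∀ {x} → x < suc N → Live (suc i) x → Live i x
          shrink _ (inj₁ x≡0) = inj₁ x≡0
          shrink _ (inj₂ i<x+1) = inj₂ (ℕ.≤-trans (ℕ.n≤1+n i) i<x+1)
          agree : ∀ {x} → x < suc N → Live (suc i) x → layout i r lp li x ≡ layout (suc i) r lp' (own (suc i)) x
          agree {x} _ (inj₁ x≡0) = layout-advance x (inj₁ x≡0) li≡lp'
          agree {x} _ (inj₂ i<x+1) = layout-advance x (inj₂ (ℕ.≤-pred i<x+1)) li≡lp'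
          cover : ∀ {x} → x < suc N → Live i x → Σ ℕ λ z → z < suc N × Live (suc i) z × layout i r lp li x ≡ layout i r lp li z
          cover {x} x< (inj₁ x≡0) = x , x< , inj₁ x≡0 , refl
          cover {x} x< (inj₂ i≤x+1) with ℕ.m≤n⇒m<n∨m≡n i≤x+1
          ... | inj₁ i<x+1 = x , x< , inj₂ i<x+1 , refl
          ... | inj₂ i≡x+1 = y , y< , y-live , subst (λ z → layout i r lp li z ≡ layout i r lp li y)
                                                      (ℕ.suc-injective (trans suc-prev i≡x+1)) prev≡y

        prev-in-hub : ∀ {r lp li} → (prev ≡ 0 ⊎ prev ≡ ℓ → lp ≡ r) → lp ≡ hub →
          Σ ℕ λ y → y < suc N × Live (suc i) y × layout i r lp li prev ≡ layout i r lp li y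
        prev-in-hub {r} {lp} {li} consistent lp≡hub =
          N , hub< , inj₂ (s≤s i≤N) , trans (layout-at-prev consistent) (trans lp≡hub (sym (layout-N {i} {r} {lp} {li})))

        prev-in-root : ∀ {r lp li} → (prev ≡ 0 ⊎ prev ≡ ℓ → lp ≡ r) → lp ≡ r →
          Σ ℕ λ y → y < suc N × Live (suc i) y × layout i r lp li prev ≡ layout i r lp li y
        prev-in-root consistent lp≡r = 0 , root< , inj₁ refl , trans (layout-at-prev consistent) lp≡r

        prev-in-cur : ∀ {r lp li} → (prev ≡ 0 ⊎ prev ≡ ℓ → lp ≡ r) → i ≢ ℓ → i ≢ N → lp ≡ li →
          Σ ℕ λ y → y < suc N × Live (suc i) y × layout i r lp li prev ≡ layout i r lp li y
        prev-in-cur consistent i≢ℓ i≢N lp≡li =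
          i , cur< , inj₂ ℕ.≤-refl , trans (layout-at-prev consistent) (trans lp≡li (sym (layout-at-cur i≢ℓ i≢N)))

        upcoming⇒live : ∀ {a} → Upcoming i a → Live i a × a < suc N
        upcoming⇒live (inj₁ refl) = inj₁ refl , root<
        upcoming⇒live (inj₂ (i≤a , a≤N)) = inj₂ (ℕ.≤-trans i≤a (ℕ.n≤1+n _)) , s≤s a≤N

        upcoming≢prev : ∀ {r lp li a} → Upcoming i a → r ≢ own prev → li ≢ own prev → layout i r lp li a ≢ own prev
        upcoming≢prev (inj₁ refl) r≢ li≢ = r≢
        upcoming≢prev {r} {lp} {li} {a} (inj₂ (i≤a , a≤N)) r≢ li≢ with a ≟ ℓ | a ≟ N | a ≟ i
        ... | yes refl | _ | _ = subst (_≢ own prev) (sym (layout-ℓ {i} {r} {lp} {li})) r≢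
        ... | no _ | yes refl | _ = λ e → case trans (sym (layout-N {i} {r} {lp} {li})) e of λ ()
        ... | no a≢ℓ | no a≢N | yes refl = subst (_≢ own prev) (sym (layout-at-cur a≢ℓ a≢N)) li≢
        ... | no a≢ℓ | no a≢N | no a≢i = λ e →
          ℕ.<-irrefl (sym (own-injective (trans (sym (layout-later i<a a≢0 a≢ℓ a≢N)) e))) prev<a
          where
          i<a : i < a
          i<a = ℕ.≤∧≢⇒< i≤a (a≢i ∘ sym)
          a≢0 : a ≢ 0
          a≢0 a≡0 = ℕ.<-irrefl (sym a≡0) (ℕ.<-≤-trans 1≤i i≤a)
          prev<a : prev < a
          prev<a = ℕ.<-trans (ℕ.≤-reflexive suc-prev) i<a

        count-prev-isolated : ∀ {f r lp li k} → Describes f (layout i r lp li) (Live i) (suc N) → i + suc k ≡ suc N →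
          layout i r lp li prev ≡ own prev → r ≢ own prev → li ≢ own prev →
          TreeCount f (edge (N + i % N) ∷ schedule (suc i) k) (suc N) 0
        count-prev-isolated {f} {r} {lp} {li} desc eq at-prev r≢ li≢ = count-none λ T within tree →
          isolated⇒¬Connected prev< hub< prev≢hub (isolated within) (proj₁ tree)
          where
          prev≢hub : f prev ≢ f N
          prev≢hub = describes-≢ desc prev< hub< live-prev live-hub
                       (λ e → case trans (sym at-prev) (trans e (layout-N {i} {r} {lp} {li})) of λ ())
          apart : ∀ {a} → Upcoming i a → f a ≢ f prev
          apart up = let (a-live , a<) = upcoming⇒live up in
            describes-≢ desc a< prev< a-live live-prev (λ e → upcoming≢prev up r≢ li≢ (trans e at-prev))
          isolated : ∀ {T} → Within (edge (N + i % N) ∷ schedule (suc i) _) T →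
                     ∀ d a b → d ∈ₛ T → ends d ≡ (a , b) → f a ≢ f prev × f b ≢ f prev
          isolated within d a b d∈T ends≡ = let (a-up , b-up) = upcoming-ends eq (within d∈T) ends≡ in apart a-up , apart b-up

        hub≢own : ∀ {x} → hub ≢ own x
        hub≢own ()

        root≢own : ∀ {x} → root ≢ own x
        root≢own ()

        root≢hub : root ≢ hub
        root≢hub ()

        own-prev≢own-cur : own prev ≢ own i
        own-prev≢own-cur e = ℕ.<-irrefl (own-injective e) (ℕ.≤-reflexive suc-prev)

        later-fixed-cur : ∀ {s} x → i < x → rl (own i) s (own x) ≡ own x
        later-fixed-cur x i<x = relabel-≢ _≟ᴸ_ (own i) _ (own x) (λ e → ℕ.<-irrefl (sym (own-injective e)) i<x)

        later-fixed-prev : ∀ {s} x → i < x → rl (own prev) s (own x) ≡ own x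
        later-fixed-prev x i<x =
          relabel-≢ _≟ᴸ_ (own prev) _ (own x) (λ e → ℕ.<-irrefl (sym (own-injective e)) (ℕ.<-trans (ℕ.≤-reflexive suc-prev) i<x))

        layout-at-hub : ∀ {r lp li} → layout i r lp li N ≡ hub
        layout-at-hub {r} {lp} {li} = layout-N {i} {r} {lp} {li}

        module Fresh {k : ℕ} (eq : i + suc k ≡ suc N) (i≢ℓ : i ≢ ℓ) (i≢N : i ≢ N) (IH : CountCorrect (suc i) k) where

          private
            v : State → ℕ
            v = count (suc i) k
            i<N : i < N
            i<N = ℕ.≤∧≢⇒< i≤N i≢N
            at-cur : ∀ {r lp li} → layout i r lp li i ≡ li
            at-cur = layout-at-cur i≢ℓ i≢N
            later : List (Fin m)
            later = edge (N + i % N) ∷ schedule (suc i) k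
            rim∉ : edge prev ∉ later
            rim∉ = rim∉schedule 1≤i eq
            spoke∉ : edge (N + i % N) ∉ schedule (suc i) k
            spoke∉ = spoke∉schedule 1≤i eq
            cur→hub cur→root prev→cur : Label → Label
            cur→hub = rl (own i) hub
            cur→root = rl (own i) root
            prev→cur = rl (own prev) (own i)

          ends-rimᵢ : ends (edge prev) ≡ (prev , i)
          ends-rimᵢ = trans (ends-rim prev<N) (cong (prev ,_) (trans (cong (_% N) suc-prev) (m<n⇒m%n≡m i<N)))

          ends-spokeᵢ : ends (edge (N + i % N)) ≡ (i , N)
          ends-spokeᵢ = trans (ends-spoke i) (cong (_, N) (m<n⇒m%n≡m i<N))

          consistent-next : ∀ σ → Consistent (suc i) σ
          consistent-next σ (inj₁ i≡0) = ⊥-elim (i≢0 i≡0)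
          consistent-next σ (inj₂ i≡ℓ) = ⊥-elim (i≢ℓ i≡ℓ)

          fresh-joined-hub : ∀ f → Consistent i joined-hub → Describes f (stateLayout i joined-hub) (Live i) (suc N) →
                             TreeCount f (schedule i (suc k)) (suc N) (freshStep v joined-hub)
          fresh-joined-hub f consistent desc = count-deletion-contraction rim∉ ends-rimᵢ prev≢cur deleted contracted
            where
            at-prev : layout i hub hub (own i) prev ≡ hub
            at-prev = layout-at-prev consistent
            prev≢cur : f prev ≢ f i
            prev≢cur = describes-≢ desc prev< cur< live-prev live-cur (λ e → hub≢own (trans (sym at-prev) (trans e at-cur)))
            cur≢hub : f i ≢ f N
            cur≢hub = describes-≢ desc cur< hub< live-cur live-hub (λ e → hub≢own (sym (trans (sym at-cur) (trans e layout-at-hub))))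
            desc-spoke : Describes (contract f i N) (layout i hub hub (cur→hub (own i))) (Live i) (suc N)
            desc-spoke = describes-layout-contract-swap desc cur< hub< live-cur live-hub at-cur layout-at-hub refl later-fixed-cur
            deleted : TreeCount f later (suc N) (v joined-own + v joined-hub)
            deleted = count-deletion-contraction spoke∉ ends-spokeᵢ cur≢hub
              (IH joined-own f (consistent-next joined-own) (describes-layout-advance desc (λ _ _ → refl) (prev-in-hub consistent refl)))
              (IH joined-hub (contract f i N) (consistent-next joined-hub)
                (describes-layout-advance desc-spoke (λ _ _ → relabel-≡ _≟ᴸ_ (own i) hub) (prev-in-hub consistent refl)))
            desc-rim : Describes (contract f prev i) (layout i hub hub (cur→hub (own i))) (Live i) (suc N)
            desc-rim = describes-layout-contract desc prev< cur< live-prev live-cur at-prev at-cur refl later-fixed-cur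
            spoke-loop : contract f prev i i ≡ contract f prev i N
            spoke-loop = describes-≡ desc-rim cur< hub< live-cur live-hub (trans at-cur (trans (relabel-≡ _≟ᴸ_ (own i) hub) (sym layout-at-hub)))
            contracted : TreeCount (contract f prev i) later (suc N) (v joined-hub)
            contracted = count-loop ends-spokeᵢ spoke-loop
              (IH joined-hub (contract f prev i) (consistent-next joined-hub)
                (describes-layout-advance desc-rim (λ _ _ → relabel-≡ _≟ᴸ_ (own i) hub) (prev-in-hub consistent refl)))

          fresh-apart-hub : ∀ f → Consistent i apart-hub → Describes f (stateLayout i apart-hub) (Live i) (suc N) →
                            TreeCount f (schedule i (suc k)) (suc N) (freshStep v apart-hub)
          fresh-apart-hub f consistent desc = count-deletion-contraction rim∉ ends-rimᵢ prev≢cur deleted contracted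
            where
            at-prev : layout i root hub (own i) prev ≡ hub
            at-prev = layout-at-prev consistent
            prev≢cur : f prev ≢ f i
            prev≢cur = describes-≢ desc prev< cur< live-prev live-cur (λ e → hub≢own (trans (sym at-prev) (trans e at-cur)))
            cur≢hub : f i ≢ f N
            cur≢hub = describes-≢ desc cur< hub< live-cur live-hub (λ e → hub≢own (sym (trans (sym at-cur) (trans e layout-at-hub))))
            desc-spoke : Describes (contract f i N) (layout i root hub (cur→hub (own i))) (Live i) (suc N)
            desc-spoke = describes-layout-contract-swap desc cur< hub< live-cur live-hub at-cur layout-at-hub refl later-fixed-cur
            deleted : TreeCount f later (suc N) (v apart-own + v apart-hub)
            deleted = count-deletion-contraction spoke∉ ends-spokeᵢ cur≢hub
              (IH apart-own f (consistent-next apart-own) (describes-layout-advance desc (λ _ _ → refl) (prev-in-hub consistent refl)))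
              (IH apart-hub (contract f i N) (consistent-next apart-hub)
                (describes-layout-advance desc-spoke (λ _ _ → relabel-≡ _≟ᴸ_ (own i) hub) (prev-in-hub consistent refl)))
            desc-rim : Describes (contract f prev i) (layout i root hub (cur→hub (own i))) (Live i) (suc N)
            desc-rim = describes-layout-contract desc prev< cur< live-prev live-cur at-prev at-cur refl later-fixed-cur
            spoke-loop : contract f prev i i ≡ contract f prev i N
            spoke-loop = describes-≡ desc-rim cur< hub< live-cur live-hub (trans at-cur (trans (relabel-≡ _≟ᴸ_ (own i) hub) (sym layout-at-hub)))
            contracted : TreeCount (contract f prev i) later (suc N) (v apart-hub)
            contracted = count-loop ends-spokeᵢ spoke-loop
              (IH apart-hub (contract f prev i) (consistent-next apart-hub)
                (describes-layout-advance desc-rim (λ _ _ → relabel-≡ _≟ᴸ_ (own i) hub) (prev-in-hub consistent refl)))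

          fresh-apart-root : ∀ f → Consistent i apart-root → Describes f (stateLayout i apart-root) (Live i) (suc N) →
                             TreeCount f (schedule i (suc k)) (suc N) (freshStep v apart-root)
          fresh-apart-root f consistent desc = count-deletion-contraction rim∉ ends-rimᵢ prev≢cur deleted contracted
            where
            at-prev : layout i root root (own i) prev ≡ root
            at-prev = layout-at-prev consistent
            prev≢cur : f prev ≢ f i
            prev≢cur = describes-≢ desc prev< cur< live-prev live-cur (λ e → root≢own (trans (sym at-prev) (trans e at-cur)))
            cur≢hub : f i ≢ f N
            cur≢hub = describes-≢ desc cur< hub< live-cur live-hub (λ e → hub≢own (sym (trans (sym at-cur) (trans e layout-at-hub))))
            desc-spoke : Describes (contract f i N) (layout i root root (cur→hub (own i))) (Live i) (suc N)
            desc-spoke = describes-layout-contract-swap desc cur< hub< live-cur live-hub at-cur layout-at-hub refl later-fixed-cur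
            deleted : TreeCount f later (suc N) (v apart-own + v apart-hub)
            deleted = count-deletion-contraction spoke∉ ends-spokeᵢ cur≢hub
              (IH apart-own f (consistent-next apart-own) (describes-layout-advance desc (λ _ _ → refl) (prev-in-root consistent refl)))
              (IH apart-hub (contract f i N) (consistent-next apart-hub)
                (describes-layout-advance desc-spoke (λ _ _ → relabel-≡ _≟ᴸ_ (own i) hub) (prev-in-root consistent refl)))
            cur-root : cur→root (own i) ≡ root
            cur-root = relabel-≡ _≟ᴸ_ (own i) root
            desc-rim : Describes (contract f prev i) (layout i root root (cur→root (own i))) (Live i) (suc N)
            desc-rim = describes-layout-contract desc prev< cur< live-prev live-cur at-prev at-cur refl later-fixed-cur
            cur≢hub′ : contract f prev i i ≢ contract f prev i N
            cur≢hub′ = describes-≢ desc-rim cur< hub< live-cur live-hub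
                         (λ e → root≢hub (trans (sym (trans at-cur cur-root)) (trans e layout-at-hub)))
            desc-rim-spoke : Describes (contract (contract f prev i) i N) (layout i hub hub (rl root hub (cur→root (own i)))) (Live i) (suc N)
            desc-rim-spoke = describes-layout-contract-swap desc-rim cur< hub< live-cur live-hub (trans at-cur cur-root)
                               layout-at-hub refl (λ _ _ → refl)
            contracted : TreeCount (contract f prev i) later (suc N) (v apart-root + v joined-hub)
            contracted = count-deletion-contraction spoke∉ ends-spokeᵢ cur≢hub′
              (IH apart-root (contract f prev i) (consistent-next apart-root)
                (describes-layout-advance desc-rim (λ _ _ → cur-root) (prev-in-root consistent refl)))
              (IH joined-hub (contract (contract f prev i) i N) (consistent-next joined-hub)
                (describes-layout-advance desc-rim-spoke (λ _ _ → cong (rl root hub) cur-root) (prev-in-hub (λ _ → refl) refl)))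

          fresh-joined-own : ∀ f → Consistent i joined-own → Describes f (stateLayout i joined-own) (Live i) (suc N) →
                             TreeCount f (schedule i (suc k)) (suc N) (freshStep v joined-own)
          fresh-joined-own f consistent desc = count-deletion-contraction rim∉ ends-rimᵢ prev≢cur deleted contracted
            where
            at-prev : layout i hub (own prev) (own i) prev ≡ own prev
            at-prev = layout-at-prev consistent
            prev-not-root : ∀ {A : Set} → prev ≡ 0 ⊎ prev ≡ ℓ → A
            prev-not-root p≡ = case consistent p≡ of λ ()
            prev≢cur : f prev ≢ f i
            prev≢cur = describes-≢ desc prev< cur< live-prev live-cur (λ e → own-prev≢own-cur (trans (sym at-prev) (trans e at-cur)))
            deleted : TreeCount f later (suc N) 0
            deleted = count-prev-isolated desc eq at-prev (λ ()) (own-prev≢own-cur ∘ sym)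
            cur-cur : prev→cur (own i) ≡ own i
            cur-cur = relabel-≢ _≟ᴸ_ (own prev) (own i) (own i) (own-prev≢own-cur ∘ sym)
            prev-cur : prev→cur (own prev) ≡ own i
            prev-cur = relabel-≡ _≟ᴸ_ (own prev) (own i)
            desc-rim : Describes (contract f prev i) (layout i hub (prev→cur (own prev)) (prev→cur (own i))) (Live i) (suc N)
            desc-rim = describes-layout-contract-swap desc prev< cur< live-prev live-cur at-prev at-cur refl later-fixed-prev
            cur≢hub : contract f prev i i ≢ contract f prev i N
            cur≢hub = describes-≢ desc-rim cur< hub< live-cur live-hub
                        (λ e → hub≢own (sym (trans (sym (trans at-cur cur-cur)) (trans e layout-at-hub))))
            desc-rim-spoke : Describes (contract (contract f prev i) i N)
                               (layout i hub (cur→hub (prev→cur (own prev))) (cur→hub (prev→cur (own i)))) (Live i) (suc N)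
            desc-rim-spoke = describes-layout-contract-swap desc-rim cur< hub< live-cur live-hub (trans at-cur cur-cur)
                               layout-at-hub refl later-fixed-cur
            contracted : TreeCount (contract f prev i) later (suc N) (v joined-own + v joined-hub)
            contracted = count-deletion-contraction spoke∉ ends-spokeᵢ cur≢hub
              (IH joined-own (contract f prev i) (consistent-next joined-own)
                (describes-layout-advance desc-rim (λ _ _ → cur-cur) (prev-in-cur prev-not-root i≢ℓ i≢N (trans prev-cur (sym cur-cur)))))
              (IH joined-hub (contract (contract f prev i) i N) (consistent-next joined-hub)
                (describes-layout-advance desc-rim-spoke (λ _ _ → trans (cong cur→hub cur-cur) (relabel-≡ _≟ᴸ_ (own i) hub))
                  (prev-in-hub prev-not-root (trans (cong cur→hub prev-cur) (relabel-≡ _≟ᴸ_ (own i) hub)))))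

          fresh-apart-own : ∀ f → Consistent i apart-own → Describes f (stateLayout i apart-own) (Live i) (suc N) →
                             TreeCount f (schedule i (suc k)) (suc N) (freshStep v apart-own)
          fresh-apart-own f consistent desc = count-deletion-contraction rim∉ ends-rimᵢ prev≢cur deleted contracted
            where
            at-prev : layout i root (own prev) (own i) prev ≡ own prev
            at-prev = layout-at-prev consistent
            prev-not-root : ∀ {A : Set} → prev ≡ 0 ⊎ prev ≡ ℓ → A
            prev-not-root p≡ = case consistent p≡ of λ ()
            prev≢cur : f prev ≢ f i
            prev≢cur = describes-≢ desc prev< cur< live-prev live-cur (λ e → own-prev≢own-cur (trans (sym at-prev) (trans e at-cur)))
            deleted : TreeCount f later (suc N) 0
            deleted = count-prev-isolated desc eq at-prev (λ ()) (own-prev≢own-cur ∘ sym)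
            cur-cur : prev→cur (own i) ≡ own i
            cur-cur = relabel-≢ _≟ᴸ_ (own prev) (own i) (own i) (own-prev≢own-cur ∘ sym)
            prev-cur : prev→cur (own prev) ≡ own i
            prev-cur = relabel-≡ _≟ᴸ_ (own prev) (own i)
            desc-rim : Describes (contract f prev i) (layout i root (prev→cur (own prev)) (prev→cur (own i))) (Live i) (suc N)
            desc-rim = describes-layout-contract-swap desc prev< cur< live-prev live-cur at-prev at-cur refl later-fixed-prev
            cur≢hub : contract f prev i i ≢ contract f prev i N
            cur≢hub = describes-≢ desc-rim cur< hub< live-cur live-hub
                        (λ e → hub≢own (sym (trans (sym (trans at-cur cur-cur)) (trans e layout-at-hub))))
            desc-rim-spoke : Describes (contract (contract f prev i) i N)
                               (layout i root (cur→hub (prev→cur (own prev))) (cur→hub (prev→cur (own i)))) (Live i) (suc N)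
            desc-rim-spoke = describes-layout-contract-swap desc-rim cur< hub< live-cur live-hub (trans at-cur cur-cur)
                               layout-at-hub refl later-fixed-cur
            contracted : TreeCount (contract f prev i) later (suc N) (v apart-own + v apart-hub)
            contracted = count-deletion-contraction spoke∉ ends-spokeᵢ cur≢hub
              (IH apart-own (contract f prev i) (consistent-next apart-own)
                (describes-layout-advance desc-rim (λ _ _ → cur-cur) (prev-in-cur prev-not-root i≢ℓ i≢N (trans prev-cur (sym cur-cur)))))
              (IH apart-hub (contract (contract f prev i) i N) (consistent-next apart-hub)
                (describes-layout-advance desc-rim-spoke (λ _ _ → trans (cong cur→hub cur-cur) (relabel-≡ _≟ᴸ_ (own i) hub))
                  (prev-in-hub prev-not-root (trans (cong cur→hub prev-cur) (relabel-≡ _≟ᴸ_ (own i) hub)))))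

          fresh-correct : ∀ σ f → Consistent i σ → Describes f (stateLayout i σ) (Live i) (suc N) →
                          TreeCount f (schedule i (suc k)) (suc N) (freshStep v σ)
          fresh-correct apart-hub = fresh-apart-hub
          fresh-correct apart-root = fresh-apart-root
          fresh-correct apart-own = fresh-apart-own
          fresh-correct joined-hub = fresh-joined-hub
          fresh-correct joined-own = fresh-joined-own

        module Root {k : ℕ} (eq : i + suc k ≡ suc N) (isRoot : IsRoot i) (IH : CountCorrect (suc i) k) where

          private
            v : State → ℕ
            v = count (suc i) k
            later : List (Fin m)
            later = edge (N + i % N) ∷ schedule (suc i) k
            rim∉ : edge prev ∉ later
            rim∉ = rim∉schedule 1≤i eq
            spoke∉ : edge (N + i % N) ∉ schedule (suc i) k
            spoke∉ = spoke∉schedule 1≤i eq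
            prev→root prev→hub : Label → Label
            prev→root = rl (own prev) root
            prev→hub = rl (own prev) hub

          -- v_i is v_ℓ or, for i = N, v₀: in both cases its number is i % N ∈ {0, ℓ}.
          c : ℕ
          c = i % N

          c-root : c ≡ ℓ ⊎ c ≡ 0
          c-root = Data.Sum.map (λ i≡ℓ → trans (cong (_% N) i≡ℓ) (m<n⇒m%n≡m ℓ<N))
                                (λ i≡N → trans (cong (_% N) i≡N) (n%n≡0 N)) isRoot

          at-c : ∀ {r lp li} → layout i r lp li c ≡ r
          at-c {r} {lp} {li} = Data.Sum.[ (λ c≡ℓ → trans (cong (layout i r lp li) c≡ℓ) (layout-ℓ {i} {r} {lp} {li}))
                                        , cong (layout i r lp li) ]′ c-root

          live-c : Live i c
          live-c = Data.Sum.[ (λ i≡ℓ → inj₂ (subst (λ z → i ≤ suc z) (sym (c≡i i≡ℓ)) (ℕ.n≤1+n i)))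
                            , (λ i≡N → inj₁ (trans (cong (_% N) i≡N) (n%n≡0 N))) ]′ isRoot
            where
            c≡i : i ≡ ℓ → c ≡ i
            c≡i i≡ℓ = trans (cong (_% N) i≡ℓ) (trans (m<n⇒m%n≡m ℓ<N) (sym i≡ℓ))

          c< : c < suc N
          c< = ℕ.<-trans (m%n<n i N) (ℕ.n<1+n N)

          ends-rimᵢ : ends (edge prev) ≡ (prev , c)
          ends-rimᵢ = trans (ends-rim prev<N) (cong (λ z → prev , z % N) suc-prev)

          ends-spokeᵢ : ends (edge (N + i % N)) ≡ (c , N)
          ends-spokeᵢ = ends-spoke i

          not-fresh : ∀ {li lp' : Label} → i ≢ ℓ → i ≢ N → li ≡ lp'
          not-fresh i≢ℓ i≢N = ⊥-elim (Data.Sum.[ i≢ℓ , i≢N ]′ isRoot)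

          root-apart-hub : ∀ f → Consistent i apart-hub → Describes f (stateLayout i apart-hub) (Live i) (suc N) →
                           TreeCount f (schedule i (suc k)) (suc N) (rootStep v apart-hub)
          root-apart-hub f consistent desc = count-deletion-contraction rim∉ ends-rimᵢ prev≢c deleted contracted
            where
            at-prev : layout i root hub (own i) prev ≡ hub
            at-prev = layout-at-prev consistent
            prev≢c : f prev ≢ f c
            prev≢c = describes-≢ desc prev< c< live-prev live-c (λ e → root≢hub (sym (trans (sym at-prev) (trans e at-c))))
            c≢hub : f c ≢ f N
            c≢hub = describes-≢ desc c< hub< live-c live-hub (λ e → root≢hub (trans (sym at-c) (trans e layout-at-hub)))
            desc-spoke : Describes (contract f c N) (layout i hub hub (own i)) (Live i) (suc N)
            desc-spoke = describes-layout-contract-swap desc c< hub< live-c live-hub at-c layout-at-hub refl (λ _ _ → refl)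
            deleted : TreeCount f later (suc N) (v apart-root + v joined-hub)
            deleted = count-deletion-contraction spoke∉ ends-spokeᵢ c≢hub
              (IH apart-root f (λ _ → refl) (describes-layout-advance desc not-fresh (prev-in-hub consistent refl)))
              (IH joined-hub (contract f c N) (λ _ → refl) (describes-layout-advance desc-spoke not-fresh (prev-in-hub (λ _ → refl) refl)))
            desc-rim : Describes (contract f prev c) (layout i hub hub (own i)) (Live i) (suc N)
            desc-rim = describes-layout-contract desc prev< c< live-prev live-c at-prev at-c refl (λ _ _ → refl)
            spoke-loop : contract f prev c c ≡ contract f prev c N
            spoke-loop = describes-≡ desc-rim c< hub< live-c live-hub (trans at-c (sym layout-at-hub))
            contracted : TreeCount (contract f prev c) later (suc N) (v joined-hub)
            contracted = count-loop ends-spokeᵢ spoke-loop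
              (IH joined-hub (contract f prev c) (λ _ → refl) (describes-layout-advance desc-rim not-fresh (prev-in-hub (λ _ → refl) refl)))

          root-apart-root : ∀ f → Consistent i apart-root → Describes f (stateLayout i apart-root) (Live i) (suc N) →
                            TreeCount f (schedule i (suc k)) (suc N) (rootStep v apart-root)
          root-apart-root f consistent desc = count-loop ends-rimᵢ rim-loop
            (count-deletion-contraction spoke∉ ends-spokeᵢ c≢hub
              (IH apart-root f (λ _ → refl) (describes-layout-advance desc not-fresh (prev-in-root consistent refl)))
              (IH joined-hub (contract f c N) (λ _ → refl) (describes-layout-advance desc-spoke not-fresh (prev-in-hub (λ _ → refl) refl))))
            where
            at-prev : layout i root root (own i) prev ≡ root
            at-prev = layout-at-prev consistent
            rim-loop : f prev ≡ f c
            rim-loop = describes-≡ desc prev< c< live-prev live-c (trans at-prev (sym at-c))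
            c≢hub : f c ≢ f N
            c≢hub = describes-≢ desc c< hub< live-c live-hub (λ e → root≢hub (trans (sym at-c) (trans e layout-at-hub)))
            desc-spoke : Describes (contract f c N) (layout i hub hub (own i)) (Live i) (suc N)
            desc-spoke = describes-layout-contract-swap desc c< hub< live-c live-hub at-c layout-at-hub refl (λ _ _ → refl)

          root-apart-own : ∀ f → Consistent i apart-own → Describes f (stateLayout i apart-own) (Live i) (suc N) →
                           TreeCount f (schedule i (suc k)) (suc N) (rootStep v apart-own)
          root-apart-own f consistent desc = count-deletion-contraction rim∉ ends-rimᵢ prev≢c deleted contracted
            where
            at-prev : layout i root (own prev) (own i) prev ≡ own prev
            at-prev = layout-at-prev consistent
            prev-not-root : ∀ {A : Set} → prev ≡ 0 ⊎ prev ≡ ℓ → A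
            prev-not-root p≡ = case consistent p≡ of λ ()
            prev≢c : f prev ≢ f c
            prev≢c = describes-≢ desc prev< c< live-prev live-c (λ e → root≢own (sym (trans (sym at-prev) (trans e at-c))))
            deleted : TreeCount f later (suc N) 0
            deleted = count-prev-isolated desc eq at-prev (λ ()) (own-prev≢own-cur ∘ sym)
            desc-rim : Describes (contract f prev c) (layout i root (prev→root (own prev)) (prev→root (own i))) (Live i) (suc N)
            desc-rim = describes-layout-contract-swap desc prev< c< live-prev live-c at-prev at-c refl later-fixed-prev
            c≢hub : contract f prev c c ≢ contract f prev c N
            c≢hub = describes-≢ desc-rim c< hub< live-c live-hub (λ e → root≢hub (trans (sym at-c) (trans e layout-at-hub)))
            desc-rim-spoke : Describes (contract (contract f prev c) c N)
                               (layout i hub (rl root hub (prev→root (own prev))) (rl root hub (prev→root (own i)))) (Live i) (suc N)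
            desc-rim-spoke = describes-layout-contract-swap desc-rim c< hub< live-c live-hub at-c layout-at-hub refl (λ _ _ → refl)
            contracted : TreeCount (contract f prev c) later (suc N) (v apart-root + v joined-hub)
            contracted = count-deletion-contraction spoke∉ ends-spokeᵢ c≢hub
              (IH apart-root (contract f prev c) (λ _ → refl)
                (describes-layout-advance desc-rim not-fresh (prev-in-root prev-not-root (relabel-≡ _≟ᴸ_ (own prev) root))))
              (IH joined-hub (contract (contract f prev c) c N) (λ _ → refl)
                (describes-layout-advance desc-rim-spoke not-fresh
                  (prev-in-hub prev-not-root (cong (rl root hub) (relabel-≡ _≟ᴸ_ (own prev) root)))))

          root-joined-hub : ∀ f → Consistent i joined-hub → Describes f (stateLayout i joined-hub) (Live i) (suc N) →
                            TreeCount f (schedule i (suc k)) (suc N) (rootStep v joined-hub)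
          root-joined-hub f consistent desc = count-loop ends-rimᵢ rim-loop (count-loop ends-spokeᵢ spoke-loop
            (IH joined-hub f (λ _ → refl) (describes-layout-advance desc not-fresh (prev-in-hub consistent refl))))
            where
            at-prev : layout i hub hub (own i) prev ≡ hub
            at-prev = layout-at-prev consistent
            rim-loop : f prev ≡ f c
            rim-loop = describes-≡ desc prev< c< live-prev live-c (trans at-prev (sym at-c))
            spoke-loop : f c ≡ f N
            spoke-loop = describes-≡ desc c< hub< live-c live-hub (trans at-c (sym layout-at-hub))

          root-joined-own : ∀ f → Consistent i joined-own → Describes f (stateLayout i joined-own) (Live i) (suc N) →
                            TreeCount f (schedule i (suc k)) (suc N) (rootStep v joined-own)
          root-joined-own f consistent desc = count-deletion-contraction rim∉ ends-rimᵢ prev≢c deleted contracted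
            where
            at-prev : layout i hub (own prev) (own i) prev ≡ own prev
            at-prev = layout-at-prev consistent
            prev-not-root : ∀ {A : Set} → prev ≡ 0 ⊎ prev ≡ ℓ → A
            prev-not-root p≡ = case consistent p≡ of λ ()
            prev≢c : f prev ≢ f c
            prev≢c = describes-≢ desc prev< c< live-prev live-c (λ e → hub≢own (sym (trans (sym at-prev) (trans e at-c))))
            deleted : TreeCount f later (suc N) 0
            deleted = count-prev-isolated desc eq at-prev (λ ()) (own-prev≢own-cur ∘ sym)
            desc-rim : Describes (contract f prev c) (layout i hub (prev→hub (own prev)) (prev→hub (own i))) (Live i) (suc N)
            desc-rim = describes-layout-contract-swap desc prev< c< live-prev live-c at-prev at-c refl later-fixed-prev
            spoke-loop : contract f prev c c ≡ contract f prev c N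
            spoke-loop = describes-≡ desc-rim c< hub< live-c live-hub (trans at-c (sym layout-at-hub))
            contracted : TreeCount (contract f prev c) later (suc N) (v joined-hub)
            contracted = count-loop ends-spokeᵢ spoke-loop
              (IH joined-hub (contract f prev c) (λ _ → refl)
                (describes-layout-advance desc-rim not-fresh (prev-in-hub prev-not-root (relabel-≡ _≟ᴸ_ (own prev) hub))))

          root-correct : ∀ σ f → Consistent i σ → Describes f (stateLayout i σ) (Live i) (suc N) →
                         TreeCount f (schedule i (suc k)) (suc N) (rootStep v σ)
          root-correct apart-hub = root-apart-hub
          root-correct apart-root = root-apart-root
          root-correct apart-own = root-apart-own
          root-correct joined-hub = root-joined-hub
          root-correct joined-own = root-joined-own

        count-correct-step : ∀ {k} → i + suc k ≡ suc N → CountCorrect (suc i) k → CountCorrect i (suc k)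
        count-correct-step eq IH σ f consistent desc with i ≟ ℓ | i ≟ N
        ... | yes i≡ℓ | _ = Root.root-correct eq (inj₁ i≡ℓ) IH σ f consistent desc
        ... | no _ | yes i≡N = Root.root-correct eq (inj₂ i≡N) IH σ f consistent desc
        ... | no i≢ℓ | no i≢N = Fresh.fresh-correct eq i≢ℓ i≢N IH σ f consistent desc

      -- After the last stage the only live vertices are v₀ and the hub, so the
      -- chosen edges form a spanning tree iff they have joined these two.
      count-correct-final : ∀ {i} → i ≡ suc N → CountCorrect i 0
      count-correct-final refl σ f consistent desc = final-count σ desc
        where
        root<' : 0 < suc N
        root<' = s≤s z≤n
        live-root : Live (suc N) 0
        live-root = inj₁ refl
        live-hub : Live (suc N) N
        live-hub = inj₂ ℕ.≤-refl
        to-hub : ∀ {f lp li} → Describes f (layout (suc N) hub lp li) (Live (suc N)) (suc N) → ∀ x → x < suc N → f x ≡ f N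
        to-hub {lp = lp} {li} desc x x< with Describes.cover desc x<
        ... | y , y< , inj₁ refl , e = trans e (describes-≡ desc y< (ℕ.n<1+n N) live-root live-hub
                                                  (sym (layout-N {suc N} {hub} {lp} {li})))
        ... | y , y< , inj₂ N<y+1 , e with ℕ.≤-antisym (ℕ.≤-pred y<) (ℕ.≤-pred N<y+1)
        ... | refl = e
        joined : ∀ {f lp li} → Describes f (layout (suc N) hub lp li) (Live (suc N)) (suc N) → TreeCount f [] (suc N) 1
        joined desc = count-[]-one λ x y x< y< → trans (to-hub desc x x<) (sym (to-hub desc y y<))
        apart : ∀ {f lp li} → Describes f (layout (suc N) root lp li) (Live (suc N)) (suc N) → TreeCount f [] (suc N) 0
        apart {lp = lp} {li} desc = count-[]-zero root<' (ℕ.n<1+n N)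
          (describes-≢ desc root<' (ℕ.n<1+n N) live-root live-hub λ e → case trans e (layout-N {suc N} {root} {lp} {li}) of λ ())
        final-count : ∀ {f} σ → Describes f (stateLayout (suc N) σ) (Live (suc N)) (suc N) → TreeCount f [] (suc N) (final σ)
        final-count apart-hub = apart
        final-count apart-root = apart
        final-count apart-own = apart
        final-count joined-hub = joined
        final-count joined-own = joined

      count-correct : ∀ k i → i + k ≡ suc N → 1 ≤ i → CountCorrect i k
      count-correct zero i eq 1≤i = count-correct-final (trans (sym (ℕ.+-identityʳ i)) eq)
      count-correct (suc k) i eq 1≤i =
        Stage.count-correct-step 1≤i (stage≤N eq) eq (count-correct k (suc i) (trans (sym (ℕ.+-suc i k)) eq) (s≤s z≤n))

      ∈-schedule⁺ : ∀ j k t → j ≤ t → t < j + k → edge (t ∸ 1) ∈ schedule j k × edge (N + t % N) ∈ schedule j k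
      ∈-schedule⁺ j zero t j≤t t< = ⊥-elim (ℕ.<-irrefl refl (ℕ.<-≤-trans t< (subst (_≤ t) (sym (ℕ.+-identityʳ j)) j≤t)))
      ∈-schedule⁺ j (suc k) t j≤t t< with ℕ.m≤n⇒m<n∨m≡n j≤t
      ... | inj₂ refl = here refl , there (here refl)
      ... | inj₁ j<t = let (rim∈ , spoke∈) = ∈-schedule⁺ (suc j) k t j<t (subst (t <_) (ℕ.+-suc j k) t<) in
                       there (there rim∈) , there (there spoke∈)

      schedule-complete : ∀ d → d ∈ schedule 1 N
      schedule-complete d with ℕ.<-cmp (toℕ d) N
      ... | tri< d<N _ _ = subst (_∈ schedule 1 N) (toℕ-injective (toℕ-edge (rim<N+N d<N)))
                              (proj₁ (∈-schedule⁺ 1 N (suc (toℕ d)) (s≤s z≤n) (s≤s d<N)))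
      ... | tri≈ _ d≡N _ = subst (_∈ schedule 1 N) (toℕ-injective (trans (toℕ-edge (spoke<N+N N)) N+N%N≡d))
                              (proj₂ (∈-schedule⁺ 1 N N (s≤s z≤n) (s≤s ℕ.≤-refl)))
        where
        N+N%N≡d : N + N % N ≡ toℕ d
        N+N%N≡d = trans (cong (N +_) (n%n≡0 N)) (trans (ℕ.+-identityʳ N) (sym d≡N))
      ... | tri> _ _ N<d = subst (_∈ schedule 1 N) (toℕ-injective (trans (toℕ-edge (spoke<N+N t)) N+t%N≡d))
                              (proj₂ (∈-schedule⁺ 1 N t (ℕ.m<n⇒0<n∸m N<d) (s≤s (ℕ.<⇒≤ t<N))))
        where
        t : ℕ
        t = toℕ d ∸ N
        t<N : t < N
        t<N = ℕ.m<n+o⇒m∸n<o (toℕ d) N (subst (toℕ d <_) (sym m≡) (toℕ<n d))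
        N+t%N≡d : N + t % N ≡ toℕ d
        N+t%N≡d = trans (cong (N +_) (m<n⇒m%n≡m t<N)) (ℕ.m+[n∸m]≡n (ℕ.<⇒≤ N<d))

module IdentifiedWheel where

  open import Defs using (Multigraph; wheel; next; mergeVertex; identify; SpanningTreeCount; IsSpanningTree)
  open Transfer using (Label; root; hub; own; own-injective; _≟ᴸ_; apart-root; module Wheel)
  open import Data.Nat using (ℕ; suc; _<_; _+_; _≟_; z≤n; s≤s)
  open import Data.Nat.Properties as ℕ using ()
  open import Data.Fin as Fin using (Fin; zero; suc; toℕ; fromℕ; inject₁; punchIn)
  open import Data.Fin.Properties using (toℕ<n; toℕ-fromℕ<; toℕ-injective; toℕ-inject₁; toℕ-fromℕ;
                                         punchOut-injective; punchInᵢ≢i; punchOut-cong; punchOut-punchIn)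
  open import Data.List using (List; []; _∷_; _++_; map; length; allFin; tabulate; lookup)
  open import Data.List.Properties using (length-map; length-++; length-tabulate)
  open import Data.Product using (_×_; _,_; Σ; proj₁; proj₂)
  open import Data.Sum using (_⊎_; inj₁; inj₂)
  open import Data.Empty using (⊥-elim)
  open import Relation.Nullary using (yes; no)
  open import Relation.Binary.PropositionalEquality using (_≡_; _≢_; refl; sym; trans; cong; cong₂)
  open import Function using (_∘_; id)
  open import Function.Bundles using (_⇔_; mk⇔; Equivalence)
  open import Data.List.Membership.Propositional using (_∈_)
  open import Data.Fin.Subset using () renaming (_∈_ to _∈ₛ_)

  lookup-map : ∀ {A B : Set} (h : A → B) (xs : List A) (i : Fin (length (map h xs))) →
    Σ (Fin (length xs)) λ i' → toℕ i' ≡ toℕ i × lookup (map h xs) i ≡ h (lookup xs i')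
  lookup-map h (x ∷ xs) zero = zero , refl , refl
  lookup-map h (x ∷ xs) (suc i) = let (i' , i'≡i , lookup≡) = lookup-map h xs i in suc i' , cong suc i'≡i , lookup≡

  lookup-++ : ∀ {A : Set} (xs ys : List A) (i : Fin (length (xs ++ ys))) →
    (Σ (Fin (length xs)) λ i' → toℕ i' ≡ toℕ i × lookup (xs ++ ys) i ≡ lookup xs i') ⊎
    (Σ (Fin (length ys)) λ i' → toℕ i ≡ length xs + toℕ i' × lookup (xs ++ ys) i ≡ lookup ys i')
  lookup-++ [] ys i = inj₂ (i , refl , refl)
  lookup-++ (x ∷ xs) ys zero = inj₁ (zero , refl , refl)
  lookup-++ (x ∷ xs) ys (suc i) with lookup-++ xs ys i
  ... | inj₁ (i' , i'≡i , lookup≡) = inj₁ (suc i' , cong suc i'≡i , lookup≡)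
  ... | inj₂ (i' , i≡ , lookup≡) = inj₂ (i' , cong suc i≡ , lookup≡)

  lookup-tabulate : ∀ {B : Set} k (f : Fin k → B) (i : Fin (length (tabulate f))) →
    Σ (Fin k) λ x → toℕ x ≡ toℕ i × lookup (tabulate f) i ≡ f x
  lookup-tabulate (suc k) f zero = zero , refl , refl
  lookup-tabulate (suc k) f (suc i) = let (x , x≡i , lookup≡) = lookup-tabulate k (f ∘ suc) i in suc x , cong suc x≡i , lookup≡

  module _ (n : ℕ) (j : Fin (suc n)) (ℓ<N : suc (toℕ j) < suc n) where

    open Wheel n (suc (toℕ j)) ℓ<N

    ℓ : ℕ
    ℓ = suc (toℕ j)

    0≢ℓ : zero ≢ suc j
    0≢ℓ ()

    φ : Fin (suc N) → Fin N
    φ = mergeVertex zero (suc j) 0≢ℓ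

    G : Multigraph N
    G = identify zero (suc j) 0≢ℓ (wheel N)

    private
      rim : Fin N → Fin (suc N) × Fin (suc N)
      rim i = inject₁ i , inject₁ (next i)
      spoke : Fin N → Fin (suc N) × Fin (suc N)
      spoke i = inject₁ i , fromℕ N
      length-rims : length (map rim (allFin N)) ≡ N
      length-rims = trans (length-map rim (allFin N)) (length-tabulate id)

    N+N≡ : N + N ≡ length G
    N+N≡ = sym (trans (length-map _ (wheel N)) (trans (length-++ (map rim (allFin N)))
             (cong₂ _+_ length-rims (trans (length-map spoke (allFin N)) (length-tabulate id)))))

    open Edges (length G) N+N≡

    wheelEnds-lookup : ∀ (e : Fin (length (wheel N))) →
      wheelEnds (toℕ e) ≡ (toℕ (proj₁ (lookup (wheel N) e)) , toℕ (proj₂ (lookup (wheel N) e)))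
    wheelEnds-lookup e with lookup-++ (map rim (allFin N)) (map spoke (allFin N)) e
    ... | inj₁ (i₁ , i₁≡e , lookup≡₁) with lookup-map rim (allFin N) i₁
    ... | i₂ , i₂≡i₁ , lookup≡₂ with lookup-tabulate N id i₂
    ... | x , x≡i₂ , lookup≡₃ rewrite lookup≡₁ | lookup≡₂ | lookup≡₃ =
      trans (cong wheelEnds e≡x) (trans (wheelEnds-rim (toℕ<n x))
        (cong₂ _,_ (sym (toℕ-inject₁ x)) (sym (trans (toℕ-inject₁ (next x)) (toℕ-fromℕ< _)))))
      where
      e≡x : toℕ e ≡ toℕ x
      e≡x = trans (sym i₁≡e) (trans (sym i₂≡i₁) (sym x≡i₂))
    wheelEnds-lookup e | inj₂ (i₁ , e≡ , lookup≡₁) with lookup-map spoke (allFin N) i₁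
    ... | i₂ , i₂≡i₁ , lookup≡₂ with lookup-tabulate N id i₂
    ... | x , x≡i₂ , lookup≡₃ rewrite lookup≡₁ | lookup≡₂ | lookup≡₃ =
      trans (cong wheelEnds e≡N+x) (trans (wheelEnds-spoke (toℕ x)) (cong₂ _,_ (sym (toℕ-inject₁ x)) (sym (toℕ-fromℕ N))))
      where
      e≡N+x : toℕ e ≡ N + toℕ x
      e≡N+x = trans e≡ (cong₂ _+_ length-rims (trans (sym i₂≡i₁) (sym x≡i₂)))

    ends-lift : ∀ e → Σ (Fin (suc N)) λ â → Σ (Fin (suc N)) λ b̂ → lookup G e ≡ (φ â , φ b̂) × ends e ≡ (toℕ â , toℕ b̂)
    ends-lift e = let (e' , e'≡e , lookup≡) = lookup-map (λ uv → φ (proj₁ uv) , φ (proj₂ uv)) (wheel N) e in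
      proj₁ (lookup (wheel N) e') , proj₂ (lookup (wheel N) e') , lookup≡ , trans (cong wheelEnds (sym e'≡e)) (wheelEnds-lookup e')

    ψ : ℕ → Label
    ψ = stateLayout 1 apart-root

    data Kind (x : ℕ) : Set where
      at-root : x ≡ 0 ⊎ x ≡ ℓ → Kind x
      at-hub : x ≡ N → Kind x
      elsewhere : x ≢ 0 → x ≢ ℓ → x ≢ N → Kind x

    kind : ∀ x → Kind x
    kind x with x ≟ 0 | x ≟ ℓ | x ≟ N
    ... | yes x≡0 | _ | _ = at-root (inj₁ x≡0)
    ... | no _ | yes x≡ℓ | _ = at-root (inj₂ x≡ℓ)
    ... | no _ | no _ | yes x≡N = at-hub x≡N
    ... | no x≢0 | no x≢ℓ | no x≢N = elsewhere x≢0 x≢ℓ x≢N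

    kindLabel : ∀ {x} → Kind x → Label
    kindLabel (at-root _) = root
    kindLabel (at-hub _) = hub
    kindLabel {x} (elsewhere _ _ _) = own x

    ψ-kind : ∀ {x} (k : Kind x) → ψ x ≡ kindLabel k
    ψ-kind (at-root (inj₁ refl)) = refl
    ψ-kind (at-root (inj₂ refl)) = layout-ℓ {1} {root} {root} {own 1}
    ψ-kind (at-hub refl) = layout-N {1} {root} {root} {own 1}
    ψ-kind {x} (elsewhere x≢0 x≢ℓ x≢N) with x ≟ 1
    ... | yes refl = layout-cur {1} {root} {root} {own 1} refl x≢0 x≢ℓ x≢N
    ... | no x≢1 = layout-later {1} {root} {root} {own 1} (ℕ.≤∧≢⇒< (ℕ.≤∧≢⇒< z≤n (x≢0 ∘ sym)) (x≢1 ∘ sym)) x≢0 x≢ℓ x≢N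

    ψ-≡⁻ : ∀ x y → ψ x ≡ ψ y → x ≡ y ⊎ (x ≡ 0 ⊎ x ≡ ℓ) × (y ≡ 0 ⊎ y ≡ ℓ)
    ψ-≡⁻ x y e = from-kinds (kind x) (kind y) (trans (sym (ψ-kind (kind x))) (trans e (ψ-kind (kind y))))
      where
      from-kinds : (kx : Kind x) (ky : Kind y) → kindLabel kx ≡ kindLabel ky → x ≡ y ⊎ (x ≡ 0 ⊎ x ≡ ℓ) × (y ≡ 0 ⊎ y ≡ ℓ)
      from-kinds (at-root x-root) (at-root y-root) _ = inj₂ (x-root , y-root)
      from-kinds (at-hub x≡N) (at-hub y≡N) _ = inj₁ (trans x≡N (sym y≡N))
      from-kinds (elsewhere _ _ _) (elsewhere _ _ _) e = inj₁ (own-injective e)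
      from-kinds (at-root _) (at-hub _) ()
      from-kinds (at-root _) (elsewhere _ _ _) ()
      from-kinds (at-hub _) (at-root _) ()
      from-kinds (at-hub _) (elsewhere _ _ _) ()
      from-kinds (elsewhere _ _ _) (at-root _) ()
      from-kinds (elsewhere _ _ _) (at-hub _) ()

    φ-ℓ : φ (suc j) ≡ zero
    φ-ℓ with suc j Fin.≟ suc j
    ... | yes _ = refl
    ... | no ℓ≢ℓ = ⊥-elim (ℓ≢ℓ refl)

    φ-root : ∀ x̂ → toℕ x̂ ≡ 0 ⊎ toℕ x̂ ≡ ℓ → φ x̂ ≡ zero
    φ-root x̂ (inj₁ x̂≡0) with toℕ-injective {i = x̂} {j = zero} x̂≡0
    ... | refl = refl
    φ-root x̂ (inj₂ x̂≡ℓ) with toℕ-injective {i = x̂} {j = suc j} x̂≡ℓ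
    ... | refl = φ-ℓ

    ψ⇒φ : ∀ x̂ ŷ → ψ (toℕ x̂) ≡ ψ (toℕ ŷ) → φ x̂ ≡ φ ŷ
    ψ⇒φ x̂ ŷ e with ψ-≡⁻ (toℕ x̂) (toℕ ŷ) e
    ... | inj₁ x̂≡ŷ = cong φ (toℕ-injective x̂≡ŷ)
    ... | inj₂ (x̂-root , ŷ-root) = trans (φ-root x̂ x̂-root) (sym (φ-root ŷ ŷ-root))

    φ⇒ψ : ∀ x̂ ŷ → φ x̂ ≡ φ ŷ → ψ (toℕ x̂) ≡ ψ (toℕ ŷ)
    φ⇒ψ x̂ ŷ e with suc j Fin.≟ x̂ | suc j Fin.≟ ŷ
    ... | yes refl | yes refl = refl
    ... | yes refl | no ℓ≢ŷ with punchOut-injective {i = suc j} {j = zero} {k = ŷ} (λ ()) ℓ≢ŷ e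
    ... | refl = layout-ℓ {1} {root} {root} {own 1}
    φ⇒ψ x̂ ŷ e | no ℓ≢x̂ | yes refl with punchOut-injective {i = suc j} {j = x̂} {k = zero} ℓ≢x̂ (λ ()) e
    ... | refl = sym (layout-ℓ {1} {root} {root} {own 1})
    φ⇒ψ x̂ ŷ e | no ℓ≢x̂ | no ℓ≢ŷ = cong (ψ ∘ toℕ) (punchOut-injective ℓ≢x̂ ℓ≢ŷ e)

    φ-surjective : ∀ u → Σ (Fin (suc N)) λ x̂ → φ x̂ ≡ u
    φ-surjective u = punchIn (suc j) u , φ-punchIn
      where
      φ-punchIn : φ (punchIn (suc j) u) ≡ u
      φ-punchIn with suc j Fin.≟ punchIn (suc j) u
      ... | yes ℓ≡ = ⊥-elim (punchInᵢ≢i (suc j) u (sym ℓ≡))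
      ... | no ℓ≢ = trans (punchOut-cong (suc j) {i≢j = ℓ≢} refl) (punchOut-punchIn (suc j))

    describes-ψ : Describes ψ ψ (Live 1) (suc N)
    describes-ψ = record { sameClass = λ _ _ _ _ → mk⇔ id id ; cover = λ {x} x< → x , x< , inj₂ (s≤s z≤n) , refl }

    IsSpanningTree⇔ : ∀ S → IsSpanningTree G S ⇔ SpanningTree ψ (_∈ₛ S) (suc N)
    IsSpanningTree⇔ = Bridge.IsSpanningTree⇔ G φ _≟ᴸ_ ψ ends ends-lift φ⇒ψ ψ⇒φ φ-surjective

    spanningTreeCount : SpanningTreeCount G (count 1 N apart-root)
    spanningTreeCount with count-correct N 1 refl (s≤s z≤n) apart-root ψ (λ _ → refl) describes-ψ
    ... | Ts , unique , mem , len = Ts , unique , mem′ , len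
      where
      mem′ : ∀ S → S ∈ Ts ⇔ IsSpanningTree G S
      mem′ S = mk⇔ (λ S∈ → Equivalence.from (IsSpanningTree⇔ S) (proj₂ (Equivalence.to (mem S) S∈)))
                   (λ tree → Equivalence.from (mem S) ((λ {d} _ → schedule-complete d) , Equivalence.to (IsSpanningTree⇔ S) tree))

module Fibonacci where

  open import Defs using (fib; luc)
  open import Data.Nat using (ℕ; zero; suc; _+_; _*_)
  open import Data.Nat.Properties as ℕ using ()
  open import Data.Nat.Tactic.RingSolver using (solve-∀)
  open import Relation.Binary.PropositionalEquality using (_≡_; refl; sym; trans; cong; cong₂; subst; module ≡-Reasoning)
  open import Algebra.Properties.CommutativeSemigroup ℕ.+-commutativeSemigroup using (interchange)
  open ≡-Reasoning

  record Recurrent (u : ℕ → ℕ) : Set where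
    field recurrence : ∀ n → u (suc (suc n)) ≡ u (suc n) + u n
  open Recurrent

  fib-recurrent : Recurrent fib
  fib-recurrent .recurrence _ = refl

  luc-recurrent : Recurrent luc
  luc-recurrent .recurrence _ = refl

  recurrent-+ : ∀ {u v} → Recurrent u → Recurrent v → Recurrent (λ n → u n + v n)
  recurrent-+ {u} {v} u-rec v-rec .recurrence n =
    trans (cong₂ _+_ (recurrence u-rec n) (recurrence v-rec n)) (interchange (u (suc n)) (u n) (v (suc n)) (v n))

  recurrent-*ˡ : ∀ c {u} → Recurrent u → Recurrent (λ n → c * u n)
  recurrent-*ˡ c {u} u-rec .recurrence n = trans (cong (c *_) (recurrence u-rec n)) (ℕ.*-distribˡ-+ c (u (suc n)) (u n))

  recurrent-*ʳ : ∀ c {u} → Recurrent u → Recurrent (λ n → u n * c)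
  recurrent-*ʳ c {u} u-rec .recurrence n = trans (cong (_* c) (recurrence u-rec n)) (ℕ.*-distribʳ-+ c (u (suc n)) (u n))

  recurrent-shift : ∀ k {u} → Recurrent u → Recurrent (λ n → u (n + k))
  recurrent-shift k u-rec .recurrence n = recurrence u-rec (n + k)

  recurrent-suc : ∀ {u} → Recurrent u → Recurrent (λ n → u (suc n))
  recurrent-suc u-rec .recurrence n = recurrence u-rec (suc n)

  recurrent-unique : ∀ u v → Recurrent u → Recurrent v → u 0 ≡ v 0 → u 1 ≡ v 1 → ∀ n → u n ≡ v n
  recurrent-unique u v u-rec v-rec u0≡v0 u1≡v1 = go
    where
    go : ∀ n → u n ≡ v n
    go zero = u0≡v0
    go (suc zero) = u1≡v1
    go (suc (suc n)) = trans (recurrence u-rec n) (trans (cong₂ _+_ (go (suc n)) (go n)) (sym (recurrence v-rec n)))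

  luc+fib≡2*fib : ∀ n → luc n + fib n ≡ 2 * fib (suc n)
  luc+fib≡2*fib = recurrent-unique (λ n → luc n + fib n) (λ n → 2 * fib (suc n)) (recurrent-+ luc-recurrent fib-recurrent)
                    (recurrent-*ˡ 2 (recurrent-suc fib-recurrent)) refl refl

  luc≡fib+fib : ∀ n → luc (suc n) ≡ fib (suc (suc n)) + fib n
  luc≡fib+fib = recurrent-unique (λ n → luc (suc n)) (λ n → fib (suc (suc n)) + fib n) (recurrent-suc luc-recurrent)
                  (recurrent-+ (recurrent-suc (recurrent-suc fib-recurrent)) fib-recurrent) refl refl

  luc+luc≡5*fib : ∀ n → luc n + luc (suc (suc n)) ≡ 5 * fib (suc n)
  luc+luc≡5*fib = recurrent-unique (λ n → luc n + luc (suc (suc n))) (λ n → 5 * fib (suc n))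
                    (recurrent-+ luc-recurrent (recurrent-suc (recurrent-suc luc-recurrent)))
                    (recurrent-*ˡ 5 (recurrent-suc fib-recurrent)) refl refl

  fib*luc+luc*fib : ∀ a b → fib a * luc b + luc a * fib b ≡ 2 * fib (a + b)
  fib*luc+luc*fib a b = recurrent-unique (λ a → fib a * luc b + luc a * fib b) (λ a → 2 * fib (a + b))
    (recurrent-+ (recurrent-*ʳ (luc b) fib-recurrent) (recurrent-*ʳ (fib b) luc-recurrent))
    (recurrent-*ˡ 2 (recurrent-shift b fib-recurrent))
    refl
    (trans (cong₂ _+_ (ℕ.+-identityʳ (luc b)) (ℕ.+-identityʳ (fib b))) (luc+fib≡2*fib b))
    a

  fib-+ : ∀ a b → fib (suc (a + b)) ≡ fib (suc a) * fib (suc b) + fib a * fib b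
  fib-+ a b = recurrent-unique (λ a → fib (suc (a + b))) (λ a → fib (suc a) * fib (suc b) + fib a * fib b)
    (recurrent-suc (recurrent-shift b fib-recurrent))
    (recurrent-+ (recurrent-*ʳ (fib (suc b)) (recurrent-suc fib-recurrent)) (recurrent-*ʳ (fib b) fib-recurrent))
    (sym (trans (ℕ.+-identityʳ _) (ℕ.+-identityʳ _)))
    (sym (cong₂ _+_ (ℕ.+-identityʳ (fib (suc b))) (ℕ.+-identityʳ (fib b))))
    a

  fib-double : ∀ n → fib (n + n) ≡ fib n * luc n
  fib-double zero = refl
  fib-double (suc n) = begin
    fib (suc (n + suc n))                                     ≡⟨ fib-+ n (suc n) ⟩
    fib (suc n) * fib (suc (suc n)) + fib n * fib (suc n)     ≡⟨ factor (fib (suc n)) (fib (suc (suc n))) (fib n) ⟩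
    fib (suc n) * (fib (suc (suc n)) + fib n)                 ≡⟨ cong (fib (suc n) *_) (luc≡fib+fib n) ⟨
    fib (suc n) * luc (suc n)                                 ∎
    where
    factor : ∀ a b c → a * b + c * a ≡ a * (b + c)
    factor = solve-∀

  double : ℕ → ℕ
  double e = e + e

  double-suc : ∀ e → double (suc e) ≡ suc (suc (double e))
  double-suc e = cong suc (ℕ.+-suc e e)

  module _ (n : ℕ) where

    private
      x : ℕ
      x = fib n
      y : ℕ
      y = fib (suc n)

    cassini-step⁺ : y * y ≡ x * (y + x) + 1 → (y + x) * (y + x) + 1 ≡ y * ((y + x) + y)
    cassini-step⁺ hyp = begin
      (y + x) * (y + x) + 1       ≡⟨ expand x y ⟩
      (y + x) * y + (x * (y + x) + 1) ≡⟨ cong ((y + x) * y +_) hyp ⟨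
      (y + x) * y + y * y         ≡⟨ collect x y ⟩
      y * ((y + x) + y)           ∎
      where
      expand : ∀ x y → (y + x) * (y + x) + 1 ≡ (y + x) * y + (x * (y + x) + 1)
      expand = solve-∀
      collect : ∀ x y → (y + x) * y + y * y ≡ y * ((y + x) + y)
      collect = solve-∀

    cassini-step⁻ : y * y + 1 ≡ x * (y + x) → (y + x) * (y + x) ≡ y * ((y + x) + y) + 1
    cassini-step⁻ hyp = begin
      (y + x) * (y + x)           ≡⟨ expand x y ⟩
      y * (y + x) + x * (y + x)   ≡⟨ cong (y * (y + x) +_) hyp ⟨
      y * (y + x) + (y * y + 1)   ≡⟨ collect x y ⟩
      y * ((y + x) + y) + 1       ∎
      where
      expand : ∀ x y → (y + x) * (y + x) ≡ y * (y + x) + x * (y + x)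
      expand = solve-∀
      collect : ∀ x y → y * (y + x) + (y * y + 1) ≡ y * ((y + x) + y) + 1
      collect = solve-∀

  cassini-even : ∀ e → fib (suc (double e)) * fib (suc (double e)) ≡ fib (double e) * fib (suc (suc (double e))) + 1
  cassini-odd : ∀ e → fib (suc (suc (double e))) * fib (suc (suc (double e))) + 1 ≡ fib (suc (double e)) * fib (suc (suc (suc (double e))))

  cassini-even zero = refl
  cassini-even (suc e) = subst (λ k → fib (suc k) * fib (suc k) ≡ fib k * fib (suc (suc k)) + 1) (sym (double-suc e))
                           (cassini-step⁻ (suc (double e)) (cassini-odd e))

  cassini-odd e = cassini-step⁺ (double e) (cassini-even e)

  fib+fib-odd : ∀ e X → fib (X + (suc (double e) + suc (double e))) + fib X ≡ luc (X + suc (double e)) * fib (suc (double e))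
  fib+fib-odd e = recurrent-unique (λ X → fib (X + (d + d)) + fib X) (λ X → luc (X + d) * fib d)
    (recurrent-+ (recurrent-shift (d + d) fib-recurrent) fib-recurrent)
    (recurrent-*ʳ (fib d) (recurrent-shift d luc-recurrent))
    (trans (ℕ.+-identityʳ _) (trans (fib-double d) (ℕ.*-comm (fib d) (luc d))))
    (begin
      fib (suc (d + d)) + 1                                   ≡⟨ cong (_+ 1) (fib-+ d d) ⟩
      fib (suc d) * fib (suc d) + fib d * fib d + 1           ≡⟨ move-1 (fib (suc d)) (fib d) ⟩
      (fib (suc d) * fib (suc d) + 1) + fib d * fib d         ≡⟨ cong (_+ fib d * fib d) (cassini-odd e) ⟩
      fib d * fib (suc (suc d)) + fib d * fib d               ≡⟨ ℕ.*-distribˡ-+ (fib d) (fib (suc (suc d))) (fib d) ⟨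
      fib d * (fib (suc (suc d)) + fib d)                     ≡⟨ cong (fib d *_) (luc≡fib+fib d) ⟨
      fib d * luc (suc d)                                     ≡⟨ ℕ.*-comm (fib d) (luc (suc d)) ⟩
      luc (suc d) * fib d                                     ∎)
    where
    d : ℕ
    d = suc (double e)
    move-1 : ∀ a b → a * a + b * b + 1 ≡ (a * a + 1) + b * b
    move-1 = solve-∀

  fib+fib-even : ∀ e X → fib (X + (double e + double e)) + fib X ≡ fib (X + double e) * luc (double e)
  fib+fib-even e = recurrent-unique (λ X → fib (X + (d + d)) + fib X) (λ X → fib (X + d) * luc d)
    (recurrent-+ (recurrent-shift (d + d) fib-recurrent) fib-recurrent)
    (recurrent-*ʳ (luc d) (recurrent-shift d fib-recurrent))
    (trans (ℕ.+-identityʳ _) (fib-double d))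
    (ℕ.+-cancelʳ-≡ (y * x) _ _ (begin
      fib (suc (d + d)) + 1 + y * x       ≡⟨ cong (λ z → z + 1 + y * x) (fib-+ d d) ⟩
      y * y + x * x + 1 + y * x           ≡⟨ regroup x y ⟩
      y * y + (x * (y + x) + 1)           ≡⟨ cong (y * y +_) (cassini-even e) ⟨
      y * y + y * y                       ≡⟨ double-square y ⟩
      y * (2 * y)                         ≡⟨ cong (y *_) (luc+fib≡2*fib d) ⟨
      y * (luc d + x)                     ≡⟨ ℕ.*-distribˡ-+ y (luc d) x ⟩
      y * luc d + y * x                   ∎))
    where
    d : ℕ
    d = double e
    x : ℕ
    x = fib d
    y : ℕ
    y = fib (suc d)
    regroup : ∀ x y → y * y + x * x + 1 + y * x ≡ y * y + (x * (y + x) + 1)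
    regroup = solve-∀
    double-square : ∀ y → y * y + y * y ≡ y * (2 * y)
    double-square = solve-∀

  luc² : ∀ e → luc (double e) * luc (double e) ≡ 5 * (fib (double e) * fib (double e)) + 4
  luc² e = ℕ.+-cancelʳ-≡ (4 * (x * y)) _ _ (begin
    l * l + 4 * (x * y)               ≡⟨ cong (l * l +_) (four-xy x y) ⟩
    l * l + 2 * x * (2 * y)           ≡⟨ cong (λ z → l * l + 2 * x * z) (luc+fib≡2*fib d) ⟨
    l * l + 2 * x * (l + x)           ≡⟨ complete-square x l ⟩
    (l + x) * (l + x) + x * x         ≡⟨ cong (λ z → z * z + x * x) (luc+fib≡2*fib d) ⟩
    (2 * y) * (2 * y) + x * x         ≡⟨ four-square x y ⟩
    4 * (y * y) + x * x               ≡⟨ cong (λ z → 4 * z + x * x) (cassini-even e) ⟩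
    4 * (x * (y + x) + 1) + x * x     ≡⟨ collect x y ⟩
    5 * (x * x) + 4 + 4 * (x * y)     ∎)
    where
    d : ℕ
    d = double e
    x : ℕ
    x = fib d
    y : ℕ
    y = fib (suc d)
    l : ℕ
    l = luc d
    four-xy : ∀ x y → 4 * (x * y) ≡ 2 * x * (2 * y)
    four-xy = solve-∀
    complete-square : ∀ x l → l * l + 2 * x * (l + x) ≡ (l + x) * (l + x) + x * x
    complete-square = solve-∀
    four-square : ∀ x y → (2 * y) * (2 * y) + x * x ≡ 4 * (y * y) + x * x
    four-square = solve-∀
    collect : ∀ x y → 4 * (x * (y + x) + 1) + x * x ≡ 5 * (x * x) + 4 + 4 * (x * y)
    collect = solve-∀

module Values where

  open import Defs using (fib; luc)
  open Transfer
  open Fibonacci using (double; double-suc; luc≡fib+fib; fib*luc+luc*fib)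
  open import Data.Nat using (ℕ; zero; suc; _+_; _*_; _<_; z≤n; s≤s)
  open import Data.Nat.Properties as ℕ using ()
  open import Data.Nat.Tactic.RingSolver using (solve-∀)
  open import Data.Sum using (inj₁; inj₂)
  open import Data.Empty using (⊥-elim)
  open import Relation.Binary.PropositionalEquality using (_≡_; _≢_; refl; sym; trans; cong; cong₂; subst; module ≡-Reasoning)
  open ≡-Reasoning

  module _ (n ℓ' : ℕ) (ℓ<N : suc ℓ' < suc n) where

    open Wheel n (suc ℓ') ℓ<N

    ℓ : ℕ
    ℓ = suc ℓ'

    -- Past v_ℓ the counts are Fibonacci and Lucas numbers; d = 2m when m + 1 stages remain.
    record AfterRoot (i k d : ℕ) : Set where
      field
        joined-hub≡ : count i k joined-hub ≡ fib (2 + d)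
        joined-own≡ : count i k joined-own ≡ fib (1 + d)
        apart-hub≡ : count i k apart-hub ≡ fib (3 + d)
        apart-own≡ : count i k apart-own ≡ fib (2 + d)
        apart-root≡ : count i k apart-root + 2 ≡ luc (2 + d)

    after-root-last : AfterRoot N 1 0
    after-root-last = record
      { joined-hub≡ = count-root 0 joined-hub (inj₂ refl)
      ; joined-own≡ = count-root 0 joined-own (inj₂ refl)
      ; apart-hub≡ = count-root 0 apart-hub (inj₂ refl)
      ; apart-own≡ = count-root 0 apart-own (inj₂ refl)
      ; apart-root≡ = cong (_+ 2) (count-root 0 apart-root (inj₂ refl)) }

    after-root-step : ∀ {i k d} → i ≢ ℓ → i ≢ N → AfterRoot (suc i) k d → AfterRoot i (suc k) (2 + d)
    after-root-step {i} {k} {d} i≢ℓ i≢N after = record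
      { joined-hub≡ = trans (fresh joined-hub) (trans (cong₂ (λ o h → (o + h) + h) joined-own≡ joined-hub≡)
                                                      (cong (_+ fib (2 + d)) (ℕ.+-comm (fib (1 + d)) (fib (2 + d)))))
      ; joined-own≡ = trans (fresh joined-own) (trans (cong₂ (λ o h → o + h) joined-own≡ joined-hub≡)
                                                      (ℕ.+-comm (fib (1 + d)) (fib (2 + d))))
      ; apart-hub≡ = trans (fresh apart-hub) (trans (cong₂ (λ o h → (o + h) + h) apart-own≡ apart-hub≡)
                                                    (cong (_+ fib (3 + d)) (ℕ.+-comm (fib (2 + d)) (fib (3 + d)))))
      ; apart-own≡ = trans (fresh apart-own) (trans (cong₂ (λ o h → o + h) apart-own≡ apart-hub≡)
                                                    (ℕ.+-comm (fib (2 + d)) (fib (3 + d))))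
      ; apart-root≡ = begin
          count i (suc k) apart-root + 2                                    ≡⟨ cong (_+ 2) (fresh apart-root) ⟩
          (v apart-own + v apart-hub) + (v apart-root + v joined-hub) + 2   ≡⟨ regroup (v apart-own) (v apart-hub) (v apart-root) (v joined-hub) ⟩
          (v apart-own + v apart-hub + v joined-hub) + (v apart-root + 2)
            ≡⟨ cong₂ _+_ (cong₂ (λ o h → o + h + v joined-hub) apart-own≡ apart-hub≡) apart-root≡ ⟩
          (fib (2 + d) + fib (3 + d) + v joined-hub) + luc (2 + d)
            ≡⟨ cong (λ h → (fib (2 + d) + fib (3 + d) + h) + luc (2 + d)) joined-hub≡ ⟩
          (fib (2 + d) + fib (3 + d) + fib (2 + d)) + luc (2 + d)
            ≡⟨ cong (λ f → f + fib (2 + d) + luc (2 + d)) (ℕ.+-comm (fib (2 + d)) (fib (3 + d))) ⟩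
          (fib (4 + d) + fib (2 + d)) + luc (2 + d)                         ≡⟨ cong (_+ luc (2 + d)) (luc≡fib+fib (2 + d)) ⟨
          luc (4 + d)                                                       ∎ }
      where
      open AfterRoot after
      v : State → ℕ
      v = count (suc i) k
      fresh : ∀ σ → count i (suc k) σ ≡ freshStep v σ
      fresh σ = count-fresh k σ i≢ℓ i≢N
      regroup : ∀ o h r j → (o + h) + (r + j) + 2 ≡ (o + h + j) + (r + 2)
      regroup = solve-∀

    after-root : ∀ m i → i + suc m ≡ suc N → ℓ < i → AfterRoot i (suc m) (double m)
    after-root zero i eq ℓ<i with trans (ℕ.+-comm 1 i) eq
    ... | refl = after-root-last
    after-root (suc m) i eq ℓ<i = subst (AfterRoot i (2 + m)) (sym (double-suc m))
      (after-root-step (λ i≡ℓ → ℕ.<-irrefl (sym i≡ℓ) ℓ<i) i≢N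
        (after-root m (suc i) (trans (sym (ℕ.+-suc i (suc m))) eq) (ℕ.<-trans ℓ<i (ℕ.n<1+n i))))
      where
      i≢N : i ≢ N
      i≢N refl = ℕ.<-irrefl (sym (ℕ.suc-injective (trans (sym (ℕ.+-suc N (suc m))) eq))) (ℕ.m<m+n N (s≤s z≤n))

    -- Before v_ℓ the counts are combinations of the counts P and Q from v_{ℓ+1} on
    -- (root joined to, resp. apart from, the hub); d = 2a when v_ℓ is a stages ahead.
    record BeforeRoot (P Q i k d : ℕ) : Set where
      field
        joined-hub≡ : count i k joined-hub ≡ fib (2 + d) * P
        joined-own≡ : count i k joined-own ≡ fib (1 + d) * P
        apart-hub≡ : count i k apart-hub ≡ fib (1 + d) * (2 * P + Q) + fib d * (P + Q)
        apart-own≡ : count i k apart-own ≡ fib d * P + fib (1 + d) * (P + Q)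
        apart-root≡ : count i k apart-root + 2 * P ≡ P * luc (2 + d) + Q * fib (2 + d)

    before-root-at-ℓ : ∀ m → BeforeRoot (count (suc ℓ) m joined-hub) (count (suc ℓ) m apart-root) ℓ (suc m) 0
    before-root-at-ℓ m = record
      { joined-hub≡ = trans (at-root joined-hub) (sym (ℕ.*-identityˡ P))
      ; joined-own≡ = trans (at-root joined-own) (sym (ℕ.*-identityˡ P))
      ; apart-hub≡ = trans (at-root apart-hub) (apart-hub-rule P Q)
      ; apart-own≡ = trans (at-root apart-own) (apart-own-rule P Q)
      ; apart-root≡ = trans (cong (_+ 2 * P) (at-root apart-root)) (apart-root-rule P Q) }
      where
      P : ℕ
      P = count (suc ℓ) m joined-hub
      Q : ℕ
      Q = count (suc ℓ) m apart-root
      at-root : ∀ σ → count ℓ (suc m) σ ≡ rootStep (count (suc ℓ) m) σ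
      at-root σ = count-root m σ (inj₁ refl)
      apart-hub-rule : ∀ P Q → (Q + P) + P ≡ 1 * (2 * P + Q) + 0 * (P + Q)
      apart-hub-rule = solve-∀
      apart-own-rule : ∀ P Q → 0 + (Q + P) ≡ 0 * P + 1 * (P + Q)
      apart-own-rule = solve-∀
      apart-root-rule : ∀ P Q → (Q + P) + 2 * P ≡ P * 3 + Q * 1
      apart-root-rule = solve-∀

    before-root-step : ∀ {P Q i k d} → i ≢ ℓ → i ≢ N → BeforeRoot P Q (suc i) k d → BeforeRoot P Q i (suc k) (2 + d)
    before-root-step {P} {Q} {i} {k} {d} i≢ℓ i≢N before = record
      { joined-hub≡ = trans (fresh joined-hub) (trans (cong₂ (λ o h → (o + h) + h) joined-own≡ joined-hub≡) (hub-rule x y P))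
      ; joined-own≡ = trans (fresh joined-own) (trans (cong₂ _+_ joined-own≡ joined-hub≡) (own-rule x y P))
      ; apart-hub≡ = trans (fresh apart-hub) (trans (cong₂ (λ o h → (o + h) + h) apart-own≡ apart-hub≡) (apart-hub-rule x y P Q))
      ; apart-own≡ = trans (fresh apart-own) (trans (cong₂ _+_ apart-own≡ apart-hub≡) (apart-own-rule x y P Q))
      ; apart-root≡ = begin
          count i (suc k) apart-root + 2 * P
            ≡⟨ cong (_+ 2 * P) (fresh apart-root) ⟩
          (v apart-own + v apart-hub) + (v apart-root + v joined-hub) + 2 * P
            ≡⟨ regroup (v apart-own) (v apart-hub) (v apart-root) (v joined-hub) P ⟩
          (v apart-own + v apart-hub + v joined-hub) + (v apart-root + 2 * P)
            ≡⟨ cong₂ _+_ (cong₂ (λ o h → o + h + v joined-hub) apart-own≡ apart-hub≡) apart-root≡ ⟩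
          (S + v joined-hub) + (P * luc (2 + d) + Q * fib (2 + d))
            ≡⟨ cong (λ h → (S + h) + (P * luc (2 + d) + Q * fib (2 + d))) joined-hub≡ ⟩
          (S + fib (2 + d) * P) + (P * luc (2 + d) + Q * fib (2 + d))
            ≡⟨ root-rule x y P Q (luc (2 + d)) ⟩
          P * ((fib (4 + d) + fib (2 + d)) + luc (2 + d)) + Q * fib (4 + d)
            ≡⟨ cong (λ l → P * (l + luc (2 + d)) + Q * fib (4 + d)) (luc≡fib+fib (2 + d)) ⟨
          P * luc (4 + d) + Q * fib (4 + d) ∎ }
      where
      open BeforeRoot before
      v : State → ℕ
      v = count (suc i) k
      fresh : ∀ σ → count i (suc k) σ ≡ freshStep v σ
      fresh σ = count-fresh k σ i≢ℓ i≢N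
      x : ℕ
      x = fib d
      y : ℕ
      y = fib (1 + d)
      S : ℕ
      S = (x * P + y * (P + Q)) + (y * (2 * P + Q) + x * (P + Q))
      hub-rule : ∀ x y P → (y * P + (y + x) * P) + (y + x) * P ≡ (((y + x) + y) + (y + x)) * P
      hub-rule = solve-∀
      own-rule : ∀ x y P → y * P + (y + x) * P ≡ ((y + x) + y) * P
      own-rule = solve-∀
      apart-hub-rule : ∀ x y P Q → ((x * P + y * (P + Q)) + (y * (2 * P + Q) + x * (P + Q))) + (y * (2 * P + Q) + x * (P + Q))
                                    ≡ ((y + x) + y) * (2 * P + Q) + (y + x) * (P + Q)
      apart-hub-rule = solve-∀
      apart-own-rule : ∀ x y P Q → (x * P + y * (P + Q)) + (y * (2 * P + Q) + x * (P + Q))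
                                    ≡ (y + x) * P + ((y + x) + y) * (P + Q)
      apart-own-rule = solve-∀
      regroup : ∀ o h r j P → (o + h) + (r + j) + 2 * P ≡ (o + h + j) + (r + 2 * P)
      regroup = solve-∀
      root-rule : ∀ x y P Q L → ((x * P + y * (P + Q)) + (y * (2 * P + Q) + x * (P + Q)) + (y + x) * P) + (P * L + Q * (y + x))
                                 ≡ P * (((((y + x) + y) + (y + x)) + (y + x)) + L) + Q * (((y + x) + y) + (y + x))
      root-rule = solve-∀

    before-root : ∀ m a i k → i + a ≡ ℓ → i + k ≡ suc N → ℓ + suc m ≡ suc N →
      BeforeRoot (count (suc ℓ) m joined-hub) (count (suc ℓ) m apart-root) i k (double a)
    before-root m zero i k i≡ℓ eq eq' with trans (sym (ℕ.+-identityʳ i)) i≡ℓ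
    ... | refl with ℕ.+-cancelˡ-≡ ℓ k (suc m) (trans eq (sym eq'))
    ... | refl = before-root-at-ℓ m
    before-root m (suc a) i zero i+a≡ℓ eq eq' = ⊥-elim (ℕ.<-irrefl (trans (sym (ℕ.+-identityʳ i)) eq) i<N+1)
      where
      i<N+1 : i < suc N
      i<N+1 = ℕ.<-trans (ℕ.<-≤-trans (ℕ.m<m+n i (s≤s z≤n)) (ℕ.≤-reflexive i+a≡ℓ)) (ℕ.<-trans ℓ<N (ℕ.n<1+n N))
    before-root m (suc a) i (suc k) i+a≡ℓ eq eq' = subst (BeforeRoot _ _ i (suc k)) (sym (double-suc a))
      (before-root-step i≢ℓ i≢N (before-root m a (suc i) k (trans (sym (ℕ.+-suc i a)) i+a≡ℓ) (trans (sym (ℕ.+-suc i k)) eq) eq'))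
      where
      i<ℓ : i < ℓ
      i<ℓ = ℕ.<-≤-trans (ℕ.m<m+n i (s≤s z≤n)) (ℕ.≤-reflexive i+a≡ℓ)
      i≢ℓ : i ≢ ℓ
      i≢ℓ i≡ℓ = ℕ.<-irrefl i≡ℓ i<ℓ
      i≢N : i ≢ N
      i≢N i≡N = ℕ.<-irrefl i≡N (ℕ.<-trans i<ℓ ℓ<N)

    count-total : ∀ m → ℓ + suc m ≡ N →
      count 1 N apart-root + 2 * fib (double (suc m)) + 2 * fib (double ℓ) ≡ 2 * fib (double ℓ + double (suc m))
    count-total m eq = begin
      τ + 2 * fib (double (suc m)) + 2 * fib (double ℓ)
                                             ≡⟨ cong₂ (λ b a → τ + 2 * fib b + 2 * fib a) (double-suc m) (double-suc ℓ') ⟩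
      τ + 2 * fib B + 2 * fib A              ≡⟨ cong (λ p → τ + 2 * p + 2 * fib A) (sym joined-hub≡) ⟩
      (τ + 2 * P) + 2 * fib A                ≡⟨ cong (_+ 2 * fib A) apart-root≡ ⟩
      P * luc A + Q * fib A + 2 * fib A      ≡⟨ regroup P Q (fib A) (luc A) ⟩
      P * luc A + (Q + 2) * fib A            ≡⟨ cong₂ (λ p q → p * luc A + q * fib A) joined-hub≡ apart-root≡′ ⟩
      fib B * luc A + luc B * fib A          ≡⟨ ℕ.+-comm (fib B * luc A) (luc B * fib A) ⟩
      luc B * fib A + fib B * luc A          ≡⟨ cong₂ _+_ (ℕ.*-comm (luc B) (fib A)) (ℕ.*-comm (fib B) (luc A)) ⟩
      fib A * luc B + luc A * fib B          ≡⟨ fib*luc+luc*fib A B ⟩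
      2 * fib (A + B)                        ≡⟨ cong₂ (λ a b → 2 * fib (a + b)) (double-suc ℓ') (double-suc m) ⟨
      2 * fib (double ℓ + double (suc m))    ∎
      where
      τ : ℕ
      τ = count 1 N apart-root
      A : ℕ
      A = 2 + double ℓ'
      B : ℕ
      B = 2 + double m
      eq' : ℓ + suc (suc m) ≡ suc N
      eq' = trans (ℕ.+-suc ℓ (suc m)) (cong suc eq)
      P : ℕ
      P = count (suc ℓ) (suc m) joined-hub
      Q : ℕ
      Q = count (suc ℓ) (suc m) apart-root
      open AfterRoot (after-root m (suc ℓ) (trans (sym (ℕ.+-suc ℓ (suc m))) eq') (ℕ.n<1+n ℓ))
        using (joined-hub≡) renaming (apart-root≡ to apart-root≡′)
      open BeforeRoot (before-root (suc m) ℓ' 1 N refl refl eq')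
        using (apart-root≡)
      regroup : ∀ P Q F L → P * L + Q * F + 2 * F ≡ P * L + (Q + 2) * F
      regroup = solve-∀

module ClosedForm where

  open import Defs using (fib; luc; alt; F; L)
  open Fibonacci using (double; double-suc; fib+fib-odd; fib+fib-even; luc²; luc+luc≡5*fib; fib-double; luc≡fib+fib)
  open import Data.Nat as ℕ using (ℕ; zero; suc; _%_; _/_; _+_; _*_; _∸_)
  open import Data.Nat.Properties as ℕ using ()
  open import Data.Nat.DivMod using (m≡m%n+[m/n]*n; [m+kn]%n≡m%n)
  import Data.Nat.Tactic.RingSolver as ℕ-Solver
  open import Data.Integer as ℤ using (+_; -_)
  import Data.Integer.Properties as ℤ
  open import Data.Integer.Tactic.RingSolver using (solve-∀)
  open import Data.Sum using (_⊎_; inj₁; inj₂)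
  open import Relation.Binary.PropositionalEquality using (_≡_; refl; sym; trans; cong; cong₂; subst; module ≡-Reasoning)
  open ≡-Reasoning

  double-+ : ∀ a b → double a + double b ≡ double (a + b)
  double-+ = solve
    where
    solve : ∀ a b → (a + a) + (b + b) ≡ (a + b) + (a + b)
    solve = ℕ-Solver.solve-∀

  spread : ∀ a d → double (a + d) ≡ double a + (d + d)
  spread = solve
    where
    solve : ∀ a d → (a + d) + (a + d) ≡ (a + a) + (d + d)
    solve = ℕ-Solver.solve-∀

  pos-double-+ : ∀ h d → + (double h + d) ≡ (+ h ℤ.+ + h) ℤ.+ + d
  pos-double-+ h d = trans (ℤ.pos-+ (h + h) d) (cong (ℤ._+ + d) (ℤ.pos-+ h h))

  double-+-% : ∀ h d → (double h + d) % 2 ≡ d % 2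
  double-+-% h d = trans (cong (_% 2) (swap h d)) ([m+kn]%n≡m%n d h 2)
    where
    swap : ∀ h d → (h + h) + d ≡ d + h * 2
    swap = ℕ-Solver.solve-∀

  odd⇒ : ∀ {d} → d % 2 ≡ 1 → d ≡ suc (double (d / 2))
  odd⇒ {d} d%2≡1 = trans (m≡m%n+[m/n]*n d 2) (trans (cong (_+ (d / 2) * 2) d%2≡1) (cong suc (half (d / 2))))
    where
    half : ∀ e → e * 2 ≡ e + e
    half = ℕ-Solver.solve-∀

  even⇒ : ∀ {d} → d % 2 ≡ 0 → d ≡ double (d / 2)
  even⇒ {d} d%2≡0 = trans (m≡m%n+[m/n]*n d 2) (trans (cong (_+ (d / 2) * 2) d%2≡0) (half (d / 2)))
    where
    half : ∀ e → e * 2 ≡ e + e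
    half = ℕ-Solver.solve-∀

  alt-double : ∀ e x → alt (double e) x ≡ x
  alt-double zero x = refl
  alt-double (suc e) x = trans (cong (λ k → alt k x) (double-suc e)) (trans (ℤ.neg-involutive (alt (double e) x)) (alt-double e x))

  F-±odd : ∀ {z} e → z ≡ + suc (double e) ⊎ z ≡ - + suc (double e) → F z ≡ + fib (suc (double e))
  F-±odd e (inj₁ refl) = refl
  F-±odd e (inj₂ refl) = alt-double e _

  L-±even : ∀ {z} e → z ≡ + double e ⊎ z ≡ - + double e → L z ≡ + luc (double e)
  L-±even e (inj₁ refl) = refl
  L-±even zero (inj₂ refl) = refl
  L-±even (suc e) (inj₂ refl) = alt-double (suc e) _

  -- N = A + B is written as N = 2h + d with h = min(A, B) and d = |A - B| = |N - 2A|.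
  record Gap (N A B : ℕ) : Set where
    field
      h d : ℕ
      N≡2h+d : N ≡ double h + d
      fib-sum : fib (double A) + fib (double B) ≡ fib (double h + (d + d)) + fib (double h)
      N-2A : + N ℤ.- + 2 ℤ.* + A ≡ + d ⊎ + N ℤ.- + 2 ℤ.* + A ≡ - + d

  gap : ∀ {N A B} → N ≡ A + B → Gap N A B
  gap {N} {A} {B} N≡A+B with ℕ.≤-<-connex A B
  ... | inj₁ A≤B = record
    { h = A ; d = d ; N≡2h+d = N≡
    ; fib-sum = trans (ℕ.+-comm (fib (double A)) (fib (double B)))
                      (cong (λ k → fib k + fib (double A)) (trans (cong double B≡) (spread A d)))
    ; N-2A = inj₁ (begin
        + N ℤ.- + 2 ℤ.* + A                 ≡⟨ cong (λ k → + k ℤ.- + 2 ℤ.* + A) N≡ ⟩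
        + (double A + d) ℤ.- + 2 ℤ.* + A    ≡⟨ cong (λ k → k ℤ.- + 2 ℤ.* + A) (pos-double-+ A d) ⟩
        (+ A ℤ.+ + A) ℤ.+ + d ℤ.- + 2 ℤ.* + A ≡⟨ cancel (+ A) (+ d) ⟩
        + d                                 ∎) }
    where
    d = B ∸ A
    B≡ : B ≡ A + d
    B≡ = sym (ℕ.m+[n∸m]≡n A≤B)
    N≡ : N ≡ double A + d
    N≡ = trans N≡A+B (trans (cong (λ b → A + b) B≡) (sym (ℕ.+-assoc A A d)))
    cancel : ∀ a x → (a ℤ.+ a) ℤ.+ x ℤ.- + 2 ℤ.* a ≡ x
    cancel = solve-∀
  ... | inj₂ B<A = record
    { h = B ; d = d ; N≡2h+d = N≡
    ; fib-sum = cong (λ k → fib k + fib (double B)) (trans (cong double A≡) (spread B d))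
    ; N-2A = inj₂ (begin
        + N ℤ.- + 2 ℤ.* + A                           ≡⟨ cong₂ (λ k a → + k ℤ.- + 2 ℤ.* a) N≡ (trans (cong +_ A≡) (ℤ.pos-+ B d)) ⟩
        + (double B + d) ℤ.- + 2 ℤ.* (+ B ℤ.+ + d)    ≡⟨ cong (λ k → k ℤ.- + 2 ℤ.* (+ B ℤ.+ + d)) (pos-double-+ B d) ⟩
        (+ B ℤ.+ + B) ℤ.+ + d ℤ.- + 2 ℤ.* (+ B ℤ.+ + d) ≡⟨ cancel (+ B) (+ d) ⟩
        - + d                                         ∎) }
    where
    d = A ∸ B
    A≡ : A ≡ B + d
    A≡ = sym (ℕ.m+[n∸m]≡n (ℕ.<⇒≤ B<A))
    N≡ : N ≡ double B + d
    N≡ = trans N≡A+B (trans (cong (_+ B) A≡) (swap B d))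
      where
      swap : ∀ b d → (b + d) + b ≡ (b + b) + d
      swap = ℕ-Solver.solve-∀
    cancel : ∀ b x → (b ℤ.+ b) ℤ.+ x ℤ.- + 2 ℤ.* (b ℤ.+ x) ≡ - x
    cancel = solve-∀

  ℤ-odd-form : ∀ τ l f F → τ + 2 * (l * f) ≡ 2 * (F * l) → + τ ≡ + 2 ℤ.* (+ F ℤ.- + f) ℤ.* + l
  ℤ-odd-form τ l f F eq = begin
    + τ                                                       ≡⟨ add-sub (+ τ) (+ 2 ℤ.* (+ l ℤ.* + f)) ⟩
    + τ ℤ.+ + 2 ℤ.* (+ l ℤ.* + f) ℤ.- + 2 ℤ.* (+ l ℤ.* + f)   ≡⟨ cong (ℤ._- + 2 ℤ.* (+ l ℤ.* + f)) eq′ ⟩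
    + 2 ℤ.* (+ F ℤ.* + l) ℤ.- + 2 ℤ.* (+ l ℤ.* + f)           ≡⟨ factor (+ l) (+ f) (+ F) ⟩
    + 2 ℤ.* (+ F ℤ.- + f) ℤ.* + l                             ∎
    where
    eq′ : + τ ℤ.+ + 2 ℤ.* (+ l ℤ.* + f) ≡ + 2 ℤ.* (+ F ℤ.* + l)
    eq′ = begin
      + τ ℤ.+ + 2 ℤ.* (+ l ℤ.* + f)   ≡⟨ cong (λ x → + τ ℤ.+ + 2 ℤ.* x) (ℤ.pos-* l f) ⟨
      + τ ℤ.+ + 2 ℤ.* + (l * f)       ≡⟨ cong (λ x → + τ ℤ.+ x) (ℤ.pos-* 2 (l * f)) ⟨
      + τ ℤ.+ + (2 * (l * f))         ≡⟨ ℤ.pos-+ τ (2 * (l * f)) ⟨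
      + (τ + 2 * (l * f))             ≡⟨ cong +_ eq ⟩
      + (2 * (F * l))                 ≡⟨ ℤ.pos-* 2 (F * l) ⟩
      + 2 ℤ.* + (F * l)               ≡⟨ cong (+ 2 ℤ.*_) (ℤ.pos-* F l) ⟩
      + 2 ℤ.* (+ F ℤ.* + l)           ∎
    add-sub : ∀ a b → a ≡ a ℤ.+ b ℤ.- b
    add-sub = solve-∀
    factor : ∀ l f F → + 2 ℤ.* (F ℤ.* l) ℤ.- + 2 ℤ.* (l ℤ.* f) ≡ + 2 ℤ.* (F ℤ.- f) ℤ.* l
    factor = solve-∀

  ℤ-even-form : ∀ τ L l F → τ + 2 * (F * l) ≡ 2 * (F * L) → L * L ≡ 5 * (F * F) + 4 →
                + τ ℤ.* (+ 5 ℤ.* + F) ≡ + 2 ℤ.* (+ L ℤ.- + l) ℤ.* (+ L ℤ.- + 2) ℤ.* (+ L ℤ.+ + 2)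
  ℤ-even-form τ L l F eq L²≡ = begin
    + τ ℤ.* (+ 5 ℤ.* + F)                                       ≡⟨ cong (ℤ._* (+ 5 ℤ.* + F)) (ℤ-odd-form τ F l L eq′) ⟩
    + 2 ℤ.* (+ L ℤ.- + l) ℤ.* + F ℤ.* (+ 5 ℤ.* + F)             ≡⟨ regroup (+ L) (+ l) (+ F) ⟩
    + 2 ℤ.* (+ L ℤ.- + l) ℤ.* (+ 5 ℤ.* (+ F ℤ.* + F))           ≡⟨ cong (λ x → + 2 ℤ.* (+ L ℤ.- + l) ℤ.* x) 5F²≡ ⟩
    + 2 ℤ.* (+ L ℤ.- + l) ℤ.* (+ L ℤ.* + L ℤ.- + 4)             ≡⟨ difference-of-squares (+ L) (+ l) ⟩
    + 2 ℤ.* (+ L ℤ.- + l) ℤ.* (+ L ℤ.- + 2) ℤ.* (+ L ℤ.+ + 2)   ∎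
    where
    add-sub : ∀ a b → a ≡ a ℤ.+ b ℤ.- b
    add-sub = solve-∀
    eq′ : τ + 2 * (F * l) ≡ 2 * (L * F)
    eq′ = trans eq (cong (2 *_) (ℕ.*-comm F L))
    5F²≡ : + 5 ℤ.* (+ F ℤ.* + F) ≡ + L ℤ.* + L ℤ.- + 4
    5F²≡ = begin
      + 5 ℤ.* (+ F ℤ.* + F)                 ≡⟨ add-sub (+ 5 ℤ.* (+ F ℤ.* + F)) (+ 4) ⟩
      + 5 ℤ.* (+ F ℤ.* + F) ℤ.+ + 4 ℤ.- + 4 ≡⟨ cong (ℤ._- + 4) cast ⟩
      + L ℤ.* + L ℤ.- + 4                   ∎
      where
      cast : + 5 ℤ.* (+ F ℤ.* + F) ℤ.+ + 4 ≡ + L ℤ.* + L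
      cast = begin
        + 5 ℤ.* (+ F ℤ.* + F) ℤ.+ + 4   ≡⟨ cong (λ x → + 5 ℤ.* x ℤ.+ + 4) (ℤ.pos-* F F) ⟨
        + 5 ℤ.* + (F * F) ℤ.+ + 4       ≡⟨ cong (ℤ._+ + 4) (ℤ.pos-* 5 (F * F)) ⟨
        + (5 * (F * F)) ℤ.+ + 4         ≡⟨ ℤ.pos-+ (5 * (F * F)) 4 ⟨
        + (5 * (F * F) + 4)             ≡⟨ cong +_ L²≡ ⟨
        + (L * L)                       ≡⟨ ℤ.pos-* L L ⟩
        + L ℤ.* + L                     ∎
    regroup : ∀ L l F → + 2 ℤ.* (L ℤ.- l) ℤ.* F ℤ.* (+ 5 ℤ.* F) ≡ + 2 ℤ.* (L ℤ.- l) ℤ.* (+ 5 ℤ.* (F ℤ.* F))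
    regroup = solve-∀
    difference-of-squares : ∀ L l → + 2 ℤ.* (L ℤ.- l) ℤ.* (L ℤ.* L ℤ.- + 4) ≡ + 2 ℤ.* (L ℤ.- l) ℤ.* (L ℤ.- + 2) ℤ.* (L ℤ.+ + 2)
    difference-of-squares = solve-∀

  module FromCount {n : ℕ} (A B τ : ℕ) (N≡A+B : suc n ≡ A + B)
           (total : τ + 2 * fib (double B) + 2 * fib (double A) ≡ 2 * fib (double A + double B)) where

    private
      N : ℕ
      N = suc n
      open Gap (gap {suc n} {A} {B} N≡A+B)

      total′ : τ + 2 * (fib (double A) + fib (double B)) ≡ 2 * (fib N * luc N)
      total′ = begin
        τ + 2 * (fib (double A) + fib (double B))     ≡⟨ regroup τ (fib (double A)) (fib (double B)) ⟩
        τ + 2 * fib (double B) + 2 * fib (double A)   ≡⟨ total ⟩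
        2 * fib (double A + double B)                 ≡⟨ cong (λ k → 2 * fib k) (trans (double-+ A B) (cong double (sym N≡A+B))) ⟩
        2 * fib (double N)                            ≡⟨ cong (2 *_) (fib-double N) ⟩
        2 * (fib N * luc N)                           ∎
        where
        regroup : ∀ t a b → t + 2 * (a + b) ≡ t + 2 * b + 2 * a
        regroup = ℕ-Solver.solve-∀

      d%2≡N%2 : d % 2 ≡ N % 2
      d%2≡N%2 = trans (sym (double-+-% h d)) (cong (_% 2) (sym N≡2h+d))

    closed-form-odd : N % 2 ≡ 1 →
      + τ ≡ + 2 ℤ.* (F (+ N) ℤ.- F (+ N ℤ.- + 2 ℤ.* + A)) ℤ.* (F (+ N ℤ.- + 1) ℤ.+ F (+ N ℤ.+ + 1))
    closed-form-odd N-odd = begin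
      + τ                                           ≡⟨ ℤ-odd-form τ (luc N) (fib d) (fib N) τ≡ ⟩
      + 2 ℤ.* (+ fib N ℤ.- + fib d) ℤ.* + luc N     ≡⟨ cong₂ (λ f l → + 2 ℤ.* (+ fib N ℤ.- f) ℤ.* l) (sym F-gap) luc-N ⟩
      + 2 ℤ.* (F (+ N) ℤ.- F (+ N ℤ.- + 2 ℤ.* + A)) ℤ.* (F (+ N ℤ.- + 1) ℤ.+ F (+ N ℤ.+ + 1)) ∎
      where
      e : ℕ
      e = d / 2
      d≡ : d ≡ suc (double e)
      d≡ = odd⇒ (trans d%2≡N%2 N-odd)
      F-gap : F (+ N ℤ.- + 2 ℤ.* + A) ≡ + fib d
      F-gap = trans (F-±odd e (subst (λ k → _ ≡ + k ⊎ _ ≡ - + k) d≡ N-2A)) (cong (λ k → + fib k) (sym d≡))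
      fib-sum′ : fib (double A) + fib (double B) ≡ luc N * fib d
      fib-sum′ = begin
        fib (double A) + fib (double B)               ≡⟨ fib-sum ⟩
        fib (double h + (d + d)) + fib (double h)     ≡⟨ subst (λ k → fib (double h + (k + k)) + fib (double h) ≡ luc (double h + k) * fib k)
                                                               (sym d≡) (fib+fib-odd e (double h)) ⟩
        luc (double h + d) * fib d                    ≡⟨ cong (λ k → luc k * fib d) N≡2h+d ⟨
        luc N * fib d                                 ∎
      τ≡ : τ + 2 * (luc N * fib d) ≡ 2 * (fib N * luc N)
      τ≡ = trans (cong (λ s → τ + 2 * s) (sym fib-sum′)) total′
      luc-N : + luc N ≡ F (+ N ℤ.- + 1) ℤ.+ F (+ N ℤ.+ + 1)
      luc-N = begin
        + luc (suc n)                                 ≡⟨ cong +_ (trans (luc≡fib+fib n) (ℕ.+-comm (fib (suc (suc n))) (fib n))) ⟩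
        + (fib n + fib (suc (suc n)))                 ≡⟨ ℤ.pos-+ (fib n) (fib (suc (suc n))) ⟩
        + fib n ℤ.+ + fib (suc (suc n))               ≡⟨ cong (λ k → + fib n ℤ.+ + fib (suc k)) (ℕ.+-comm 1 n) ⟩
        F (+ N ℤ.- + 1) ℤ.+ F (+ N ℤ.+ + 1)           ∎

    closed-form-even : N % 2 ≡ 0 →
      + τ ℤ.* (L (+ N ℤ.- + 1) ℤ.+ L (+ N ℤ.+ + 1)) ≡
        + 2 ℤ.* (L (+ N) ℤ.- L (+ N ℤ.- + 2 ℤ.* + A)) ℤ.* (L (+ N) ℤ.- + 2) ℤ.* (L (+ N) ℤ.+ + 2)
    closed-form-even N-even = begin
      + τ ℤ.* (L (+ N ℤ.- + 1) ℤ.+ L (+ N ℤ.+ + 1))  ≡⟨ cong (+ τ ℤ.*_) 5F-N ⟩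
      + τ ℤ.* (+ 5 ℤ.* + fib N)                      ≡⟨ ℤ-even-form τ (luc N) (luc d) (fib N) τ≡ L²-N ⟩
      + 2 ℤ.* (+ luc N ℤ.- + luc d) ℤ.* (+ luc N ℤ.- + 2) ℤ.* (+ luc N ℤ.+ + 2)
        ≡⟨ cong (λ l → + 2 ℤ.* (+ luc N ℤ.- l) ℤ.* (+ luc N ℤ.- + 2) ℤ.* (+ luc N ℤ.+ + 2)) (sym L-gap) ⟩
      + 2 ℤ.* (L (+ N) ℤ.- L (+ N ℤ.- + 2 ℤ.* + A)) ℤ.* (L (+ N) ℤ.- + 2) ℤ.* (L (+ N) ℤ.+ + 2) ∎
      where
      e : ℕ
      e = d / 2
      d≡ : d ≡ double e
      d≡ = even⇒ (trans d%2≡N%2 N-even)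
      L-gap : L (+ N ℤ.- + 2 ℤ.* + A) ≡ + luc d
      L-gap = trans (L-±even e (subst (λ k → _ ≡ + k ⊎ _ ≡ - + k) d≡ N-2A)) (cong (λ k → + luc k) (sym d≡))
      fib-sum′ : fib (double A) + fib (double B) ≡ fib N * luc d
      fib-sum′ = begin
        fib (double A) + fib (double B)               ≡⟨ fib-sum ⟩
        fib (double h + (d + d)) + fib (double h)     ≡⟨ subst (λ k → fib (double h + (k + k)) + fib (double h) ≡ fib (double h + k) * luc k)
                                                               (sym d≡) (fib+fib-even e (double h)) ⟩
        fib (double h + d) * luc d                    ≡⟨ cong (λ k → fib k * luc d) N≡2h+d ⟨
        fib N * luc d                                 ∎
      τ≡ : τ + 2 * (fib N * luc d) ≡ 2 * (fib N * luc N)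
      τ≡ = trans (cong (λ s → τ + 2 * s) (sym fib-sum′)) total′
      N≡2e' : N ≡ double (h + e)
      N≡2e' = trans N≡2h+d (trans (cong (λ k → double h + k) d≡) (double-+ h e))
      L²-N : luc N * luc N ≡ 5 * (fib N * fib N) + 4
      L²-N = subst (λ k → luc k * luc k ≡ 5 * (fib k * fib k) + 4) (sym N≡2e') (luc² (h + e))
      5F-N : L (+ N ℤ.- + 1) ℤ.+ L (+ N ℤ.+ + 1) ≡ + 5 ℤ.* + fib N
      5F-N = begin
        L (+ N ℤ.- + 1) ℤ.+ L (+ N ℤ.+ + 1)           ≡⟨ cong (λ k → + luc n ℤ.+ + luc (suc k)) (ℕ.+-comm n 1) ⟩
        + luc n ℤ.+ + luc (suc (suc n))               ≡⟨ ℤ.pos-+ (luc n) (luc (suc (suc n))) ⟨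
        + (luc n + luc (suc (suc n)))                 ≡⟨ cong +_ (luc+luc≡5*fib n) ⟩
        + (5 * fib N)                                 ≡⟨ ℤ.pos-* 5 (fib N) ⟩
        + 5 ℤ.* + fib N                               ∎

open import Defs
open import Data.Nat using (ℕ; _≤_; _<_; _∸_; suc; _%_; s≤s)
import Data.Nat as ℕ
open import Data.Nat.Properties using (+-suc; m+[n∸m]≡n)
open import Data.Integer using (ℤ; +_; _+_; _-_; _*_)
open import Data.Fin using (Fin; zero; suc; toℕ)
open import Data.Product using (_×_; Σ; _,_)
open import Relation.Binary.PropositionalEquality using (_≡_; sym; trans; cong)

theorem7 : (N : ℕ) → 3 ≤ N → (j : Fin N) → suc (toℕ j) ≤ N ∸ 1 →
    Σ ℕ λ τ → SpanningTreeCount (identify zero (suc j) (λ ()) (wheel N)) τ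
      × (N % 2 ≡ 1 →
        + τ ≡ + 2 * (F (+ N) - F (+ N - + 2 * + suc (toℕ j)))
                  * (F (+ N - + 1) + F (+ N + + 1)))
      × (N % 2 ≡ 0 →
        + τ * (L (+ N - + 1) + L (+ N + + 1))
          ≡ + 2 * (L (+ N) - L (+ N - + 2 * + suc (toℕ j)))
                * (L (+ N) - + 2) * (L (+ N) + + 2))
theorem7 (suc n) _ j ℓ≤n = τ , IdentifiedWheel.spanningTreeCount n j ℓ<N , closed-form-odd , closed-form-even
  where
  ℓ : ℕ
  ℓ = suc (toℕ j)
  ℓ<N : ℓ < suc n
  ℓ<N = s≤s ℓ≤n
  m : ℕ
  m = n ∸ ℓ
  N≡ℓ+m+1 : suc n ≡ ℓ ℕ.+ suc m
  N≡ℓ+m+1 = sym (trans (+-suc ℓ m) (cong suc (m+[n∸m]≡n ℓ≤n)))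
  τ : ℕ
  τ = Transfer.Wheel.count n ℓ ℓ<N 1 (suc n) Transfer.apart-root
  open ClosedForm.FromCount ℓ (suc m) τ N≡ℓ+m+1 (Values.count-total n (toℕ j) ℓ<N m (sym N≡ℓ+m+1))
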